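{- For any formula $A$ of $\mathcal{L}^\omega_*$, $$\mathrm{IL}^{\omega}_*+\mathrm{AC}^{\omega}_*+\mathrm{IP}^*_{\not\exists}\vdash A\leftrightarrow A^{HR}.$$
   Context: Fix a first-order language $\mathcal{L}$ with at least one constant symbol. Types: $G$; $\sigma\to\tau$; $\sigma^*$. Constants: function symbols of $\mathcal{L}$; $\Pi_{\sigma,\tau}:\sigma\to\tau\to\sigma$; $\Sigma_{\rho,\sigma,\tau}:(\rho\to\sigma\to\tau)\to(\rho\to\sigma)\to\rho\to\tau$; $\mathfrak{s}_\sigma:\sigma\to\sigma^*$; $\cup_\sigma:\sigma^*\to\sigma^*\to\sigma^*$; $\bigcup_{\sigma,\tau}:\sigma^*\to(\sigma\to\tau^*)\to\tau^*$. Terms: constants, typed variables, applications. Atomic formulas: $\bot$, $t=_\rho q$, $t\in_\rho q$ ($q:\rho^*$), $R(t_1,\dots,t_n)$. Formulas of $\mathcal{L}^\omega_*$: closed under $\lor,\land,\to,\forall x,\exists x$ and bounded quantifiers $\forall x\in t,\exists x\in t$. A formula is $\exists$-free if it contains no unbounded $\exists x$. $\mathrm{IL}^{\omega}_*$ is intuitionistic predicate logic in all finite types with: $x=x$; $x=y\land A\to A'$ ($A$ atomic); $\forall x\in t\,A\leftrightarrow\forall x(x\in t\to A)$; $\exists x\in t\,A\leftrightarrow\exists x(x\in t\land A)$; $\Sigma xyz=xz(yz)$; $\Pi xy=x$; $w\in\mathfrak{s}x\leftrightarrow w=x$; $w\in\cup xy\leftrightarrow w\in x\lor w\in y$; $z\in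 x\land w\in yz\to w\in\bigcup xy$; $\bigcup(\mathfrak{s}x)y=yx$; $\bigcup(\cup xy)z=\cup(\bigcup xz)(\bigcup yz)$. $\mathrm{AC}^{\omega}_*$: $\forall x^\rho\exists y^\sigma A(x,y)\to\exists f^{\rho\to\sigma^*}\forall x\exists y\in fx\,A(x,y)$. $\mathrm{IP}^*_{\not\exists}$: $(B(x)\to\exists y\,A(y))\to\exists w(B(x)\to\exists y\in w\,A(y))$ for $\exists$-free $B$. The translation $A^{HR}\equiv\exists\underline{x}\,A_{HR}(\underline{x})$ ($A_{HR}$ $\exists$-free) is defined by: atomic $A$: $A^{HR}:\equiv A_{HR}:\equiv A$; $(A\lor B)^{HR}:\equiv\exists\underline{x},\underline{u}(A_{HR}(\underline{x})\lor B_{HR}(\underline{u}))$; $(A\land B)^{HR}:\equiv\exists\underline{x},\underline{u}(A_{HR}(\underline{x})\land B_{HR}(\underline{u}))$; $(A\to B)^{HR}:\equiv\exists\underline{U}\forall\underline{x}(A_{HR}(\underline{x})\to B_{HR}(\underline{U}\underline{x}))$; $(\exists zA(z))^{HR}:\equiv\exists Z,\underline{x}\,\exists z\in Z\,A_{HR}(z,\underline{x})$; $(\forall zA(z))^{HR}:\equiv\exists\underline{X}\forall z\,A_{HR}(z,\underline{X}z)$; $(\exists z\in t\,A(z))^{HR}:\equiv\exists\underline{x}\exists z\in t\,A_{HR}(z,\underline{x})$; $(\forall z\in t\,A(z))^{HR}:\equiv\exists\underline{x}\forall z\in t\,A_{HR}(z,\underline{x})$, where $A^{HR}\equiv\exists\underline{x}A_{HR}(\underline{x})$,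 $B^{HR}\equiv\exists\underline{u}B_{HR}(\underline{u})$. -}

module Defs where

open import Data.Nat using (ℕ; zero; suc)
open import Data.List using (List; []; _∷_; _++_; map)
open import Data.Vec using (Vec)
import Data.Vec as Vec
open import Data.Sum using (_⊎_; inj₁; inj₂; [_,_])
open import Data.Unit using (⊤)
open import Data.Empty using (⊥)
open import Data.List.Membership.Propositional using (_∈_)
open import Data.Product using (_×_)
open import Function using (_∘_)

record Language : Set₁ where
  field
    Fun   : ℕ → Set
    Rel   : ℕ → Set
    const : Fun 0

data Ty : Set where
  G    : Ty
  _⇒_  : Ty → Ty → Ty
  _*   : Ty → Ty

infixr 20 _⇒_
infix  25 _*

arrows : List Ty → Ty → Ty
arrows []       τ = τ
arrows (σ ∷ σs) τ = σ ⇒ arrows σs τ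

Gⁿ⇒G : ℕ → Ty
Gⁿ⇒G zero    = G
Gⁿ⇒G (suc n) = G ⇒ Gⁿ⇒G n

Ctx : Set
Ctx = List Ty

-- typed de Bruijn variables (head of the context = innermost binder)
data Var : Ctx → Ty → Set where
  vz : ∀ {Γ σ} → Var (σ ∷ Γ) σ
  vs : ∀ {Γ σ τ} → Var Γ τ → Var (σ ∷ Γ) τ

inl : ∀ {Γ τ} (xs : Ctx) → Var xs τ → Var (xs ++ Γ) τ
inl (x ∷ xs) vz     = vz
inl (x ∷ xs) (vs v) = vs (inl xs v)

inr : ∀ {Γ τ} (xs : Ctx) → Var Γ τ → Var (xs ++ Γ) τ
inr []       v = v
inr (x ∷ xs) v = vs (inr xs v)

split : ∀ {Γ τ} (xs : Ctx) → Var (xs ++ Γ) τ → Var xs τ ⊎ Var Γ τ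
split []       v      = inj₂ v
split (x ∷ xs) vz     = inj₁ vz
split (x ∷ xs) (vs v) with split xs v
... | inj₁ w = inj₁ (vs w)
... | inj₂ w = inj₂ w

mapVar : ∀ {xs τ} (f : Ty → Ty) → Var xs τ → Var (map f xs) (f τ)
mapVar f vz     = vz
mapVar f (vs v) = vs (mapVar f v)

module Logic (L : Language) where
  open Language L

  data Tm (Γ : Ctx) : Ty → Set where
    var    : ∀ {σ} → Var Γ σ → Tm Γ σ
    fn     : ∀ {n} → Fun n → Tm Γ (Gⁿ⇒G n)
    Πc     : ∀ {σ τ} → Tm Γ (σ ⇒ τ ⇒ σ)
    Σc     : ∀ {ρ σ τ} → Tm Γ ((ρ ⇒ σ ⇒ τ) ⇒ (ρ ⇒ σ) ⇒ ρ ⇒ τ)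
    sng    : ∀ {σ} → Tm Γ (σ ⇒ σ *)
    cup    : ∀ {σ} → Tm Γ (σ * ⇒ σ * ⇒ σ *)
    bigcup : ∀ {σ τ} → Tm Γ (σ * ⇒ (σ ⇒ τ *) ⇒ τ *)
    app    : ∀ {σ τ} → Tm Γ (σ ⇒ τ) → Tm Γ σ → Tm Γ τ

  data Fm (Γ : Ctx) : Set where
    Bot  : Fm Γ
    Eq   : ∀ {ρ} → Tm Γ ρ → Tm Γ ρ → Fm Γ
    Mem  : ∀ {ρ} → Tm Γ ρ → Tm Γ (ρ *) → Fm Γ
    R    : ∀ {n} → Rel n → Vec (Tm Γ G) n → Fm Γ
    Or   : Fm Γ → Fm Γ → Fm Γ
    And  : Fm Γ → Fm Γ → Fm Γ
    Imp  : Fm Γ → Fm Γ → Fm Γ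
    All  : (σ : Ty) → Fm (σ ∷ Γ) → Fm Γ
    Ex   : (σ : Ty) → Fm (σ ∷ Γ) → Fm Γ
    BAll : ∀ {σ} → Tm Γ (σ *) → Fm (σ ∷ Γ) → Fm Γ
    BEx  : ∀ {σ} → Tm Γ (σ *) → Fm (σ ∷ Γ) → Fm Γ

  Iff : ∀ {Γ} → Fm Γ → Fm Γ → Fm Γ
  Iff A B = And (Imp A B) (Imp B A)

  data Atomic {Γ : Ctx} : Fm Γ → Set where
    at-bot : Atomic Bot
    at-eq  : ∀ {ρ} {t q : Tm Γ ρ} → Atomic (Eq t q)
    at-mem : ∀ {ρ} {t : Tm Γ ρ} {q : Tm Γ (ρ *)} → Atomic (Mem t q)
    at-rel : ∀ {n} {r : Rel n} {ts : Vec (Tm Γ G) n} → Atomic (R r ts)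

  ExFree : ∀ {Γ} → Fm Γ → Set
  ExFree Bot        = ⊤
  ExFree (Eq t q)   = ⊤
  ExFree (Mem t q)  = ⊤
  ExFree (R r ts)   = ⊤
  ExFree (Or A B)   = ExFree A × ExFree B
  ExFree (And A B)  = ExFree A × ExFree B
  ExFree (Imp A B)  = ExFree A × ExFree B
  ExFree (All σ A)  = ExFree A
  ExFree (Ex σ A)   = ⊥
  ExFree (BAll t A) = ExFree A
  ExFree (BEx t A)  = ExFree A

  Sub : Ctx → Ctx → Set
  Sub Γ Δ = ∀ {τ} → Var Γ τ → Tm Δ τ

  subT : ∀ {Γ Δ τ} → Sub Γ Δ → Tm Γ τ → Tm Δ τ
  subT s (var x)   = s x
  subT s (fn f)    = fn f
  subT s Πc        = Πc
  subT s Σc        = Σc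
  subT s sng       = sng
  subT s cup       = cup
  subT s bigcup    = bigcup
  subT s (app t u) = app (subT s t) (subT s u)

  wkT : ∀ {Γ σ τ} → Tm Γ τ → Tm (σ ∷ Γ) τ
  wkT = subT (var ∘ vs)

  _▸_ : ∀ {Γ Δ σ} → Tm Δ σ → Sub Γ Δ → Sub (σ ∷ Γ) Δ
  (t ▸ s) vz     = t
  (t ▸ s) (vs x) = s x

  lift : ∀ {Γ Δ σ} → Sub Γ Δ → Sub (σ ∷ Γ) (σ ∷ Δ)
  lift s = var vz ▸ (wkT ∘ s)

  subF : ∀ {Γ Δ} → Sub Γ Δ → Fm Γ → Fm Δ
  subF s Bot        = Bot
  subF s (Eq t q)   = Eq (subT s t) (subT s q)
  subF s (Mem t q)  = Mem (subT s t) (subT s q)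
  subF s (R r ts)   = R r (Vec.map (subT s) ts)
  subF s (Or A B)   = Or (subF s A) (subF s B)
  subF s (And A B)  = And (subF s A) (subF s B)
  subF s (Imp A B)  = Imp (subF s A) (subF s B)
  subF s (All σ A)  = All σ (subF (lift s) A)
  subF s (Ex σ A)   = Ex σ (subF (lift s) A)
  subF s (BAll t A) = BAll (subT s t) (subF (lift s) A)
  subF s (BEx t A)  = BEx (subT s t) (subF (lift s) A)

  wkF : ∀ {Γ σ} → Fm Γ → Fm (σ ∷ Γ)
  wkF = subF (var ∘ vs)

  _[_] : ∀ {Γ σ} → Fm (σ ∷ Γ) → Tm Γ σ → Fm Γ
  A [ t ] = subF (t ▸ var) A

  glue : ∀ {Γ Δ} (xs : Ctx) → (∀ {τ} → Var xs τ → Tm Δ τ) → Sub Γ Δ → Sub (xs ++ Γ) Δ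
  glue xs f g v = [ f , g ] (split xs v)

  exN : ∀ {Γ} (xs : Ctx) → Fm (xs ++ Γ) → Fm Γ
  exN []       A = A
  exN (x ∷ xs) A = exN xs (Ex x A)

  allN : ∀ {Γ} (xs : Ctx) → Fm (xs ++ Γ) → Fm Γ
  allN []       A = A
  allN (x ∷ xs) A = allN xs (All x A)

  appVars : ∀ {Δ τ} (xs : Ctx) → Tm Δ (arrows xs τ) → (∀ {σ} → Var xs σ → Tm Δ σ) → Tm Δ τ
  appVars []       t f = t
  appVars (x ∷ xs) t f = appVars xs (app t (f vz)) (f ∘ vs)

  -- The HR translation: A^HR ≡ ∃ x̲ A_HR(x̲), with wt A the types of x̲
  wt : ∀ {Γ} → Fm Γ → Ctx
  wt Bot        = []
  wt (Eq t q)   = []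
  wt (Mem t q)  = []
  wt (R r ts)   = []
  wt (Or A B)   = wt A ++ wt B
  wt (And A B)  = wt A ++ wt B
  wt (Imp A B)  = map (arrows (wt A)) (wt B)
  wt (All σ A)  = map (σ ⇒_) (wt A)
  wt (Ex σ A)   = (σ *) ∷ wt A
  wt (BAll t A) = wt A
  wt (BEx t A)  = wt A

  hr : ∀ {Γ} (A : Fm Γ) → Fm (wt A ++ Γ)
  hr Bot       = Bot
  hr (Eq t q)  = Eq t q
  hr (Mem t q) = Mem t q
  hr (R r ts)  = R r ts
  hr {Γ} (Or A B) =
    Or (subF (glue a (λ x → var (inl (a ++ b) (inl a x))) (var ∘ inr (a ++ b))) (hr A))
       (subF (glue b (λ x → var (inl (a ++ b) (inr a x))) (var ∘ inr (a ++ b))) (hr B))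
    where a = wt A ; b = wt B
  hr {Γ} (And A B) =
    And (subF (glue a (λ x → var (inl (a ++ b) (inl a x))) (var ∘ inr (a ++ b))) (hr A))
        (subF (glue b (λ x → var (inl (a ++ b) (inr a x))) (var ∘ inr (a ++ b))) (hr B))
    where a = wt A ; b = wt B
  hr {Γ} (Imp A B) =
    allN a (Imp (subF (glue a (var ∘ inl a) (var ∘ inr a ∘ inr Us)) (hr A))
                (subF (glue (wt B)
                         (λ i → appVars a (var (inr a (inl Us (mapVar (arrows a) i)))) (var ∘ inl a))
                         (var ∘ inr a ∘ inr Us)) (hr B)))
    where a = wt A ; Us = map (arrows (wt A)) (wt B)
  hr {Γ} (All σ A) =
    All σ (subF (glue (wt A)
                   (λ x → app (var (vs (inl Xs (mapVar (σ ⇒_) x)))) (var vz))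
                   (var vz ▸ (var ∘ vs ∘ inr Xs))) (hr A))
    where Xs = map (σ ⇒_) (wt A)
  hr {Γ} (Ex σ A) =
    BEx (var vz) (subF (glue (wt A) (var ∘ vs ∘ vs ∘ inl (wt A))
                         (var vz ▸ (var ∘ vs ∘ vs ∘ inr (wt A)))) (hr A))
  hr {Γ} (BAll t A) =
    BAll (subT (var ∘ inr (wt A)) t)
         (subF (glue (wt A) (var ∘ vs ∘ inl (wt A)) (var vz ▸ (var ∘ vs ∘ inr (wt A)))) (hr A))
  hr {Γ} (BEx t A) =
    BEx (subT (var ∘ inr (wt A)) t)
        (subF (glue (wt A) (var ∘ vs ∘ inl (wt A)) (var vz ▸ (var ∘ vs ∘ inr (wt A)))) (hr A))

  HR : ∀ {Γ} → Fm Γ → Fm Γ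
  HR A = exN (wt A) (hr A)

  data Axiom {Γ : Ctx} : Fm Γ → Set where
    eq-refl  : ∀ {ρ} (x : Tm Γ ρ) → Axiom (Eq x x)
    eq-subst : ∀ {ρ} (A : Fm (ρ ∷ Γ)) → Atomic A → (x y : Tm Γ ρ) →
               Axiom (Imp (And (Eq x y) (A [ x ])) (A [ y ]))
    ball-def : ∀ {σ} (t : Tm Γ (σ *)) (A : Fm (σ ∷ Γ)) →
               Axiom (Iff (BAll t A) (All σ (Imp (Mem (var vz) (wkT t)) A)))
    bex-def  : ∀ {σ} (t : Tm Γ (σ *)) (A : Fm (σ ∷ Γ)) →
               Axiom (Iff (BEx t A) (Ex σ (And (Mem (var vz) (wkT t)) A)))
    Σ-ax     : ∀ {ρ σ τ} (x : Tm Γ (ρ ⇒ σ ⇒ τ)) (y : Tm Γ (ρ ⇒ σ)) (z : Tm Γ ρ) →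
               Axiom (Eq (app (app (app Σc x) y) z) (app (app x z) (app y z)))
    Π-ax     : ∀ {σ τ} (x : Tm Γ σ) (y : Tm Γ τ) → Axiom (Eq (app (app Πc x) y) x)
    sng-ax   : ∀ {σ} (w x : Tm Γ σ) → Axiom (Iff (Mem w (app sng x)) (Eq w x))
    cup-ax   : ∀ {σ} (w : Tm Γ σ) (x y : Tm Γ (σ *)) →
               Axiom (Iff (Mem w (app (app cup x) y)) (Or (Mem w x) (Mem w y)))
    bigcup-mem : ∀ {σ τ} (z : Tm Γ σ) (x : Tm Γ (σ *)) (w : Tm Γ τ) (y : Tm Γ (σ ⇒ τ *)) →
               Axiom (Imp (And (Mem z x) (Mem w (app y z))) (Mem w (app (app bigcup x) y)))
    bigcup-sng : ∀ {σ τ} (x : Tm Γ σ) (y : Tm Γ (σ ⇒ τ *)) →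
               Axiom (Eq (app (app bigcup (app sng x)) y) (app y x))
    bigcup-cup : ∀ {σ τ} (x y : Tm Γ (σ *)) (z : Tm Γ (σ ⇒ τ *)) →
               Axiom (Eq (app (app bigcup (app (app cup x) y)) z)
                         (app (app cup (app (app bigcup x) z)) (app (app bigcup y) z)))
    -- AC^ω_* : ∀x^ρ ∃y^σ A(x,y) → ∃f^{ρ→σ*} ∀x ∃y∈fx A(x,y)
    ac       : ∀ {ρ σ} (A : Fm (σ ∷ ρ ∷ Γ)) →
               Axiom (Imp (All ρ (Ex σ A))
                          (Ex (ρ ⇒ σ *) (All ρ (BEx (app (var (vs vz)) (var vz))
                              (subF (var vz ▸ (var (vs vz) ▸ (var ∘ vs ∘ vs ∘ vs))) A)))))
    -- IP^*_∄ : (B → ∃y A(y)) → ∃w (B → ∃y∈w A(y)),  B ∃-free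
    ip       : ∀ {σ} (B : Fm Γ) → ExFree B → (A : Fm (σ ∷ Γ)) →
               Axiom (Imp (Imp B (Ex σ A))
                          (Ex (σ *) (Imp (wkF B) (BEx (var vz) (subF (var vz ▸ (var ∘ vs ∘ vs)) A)))))

  infix 4 _⊢_
  data _⊢_ {Γ : Ctx} (Δ : List (Fm Γ)) : Fm Γ → Set where
    hyp   : ∀ {A} → A ∈ Δ → Δ ⊢ A
    ax    : ∀ {A} → Axiom A → Δ ⊢ A
    botE  : ∀ {A} → Δ ⊢ Bot → Δ ⊢ A
    andI  : ∀ {A B} → Δ ⊢ A → Δ ⊢ B → Δ ⊢ And A B
    andE₁ : ∀ {A B} → Δ ⊢ And A B → Δ ⊢ A
    andE₂ : ∀ {A B} → Δ ⊢ And A B → Δ ⊢ B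
    orI₁  : ∀ {A B} → Δ ⊢ A → Δ ⊢ Or A B
    orI₂  : ∀ {A B} → Δ ⊢ B → Δ ⊢ Or A B
    orE   : ∀ {A B C} → Δ ⊢ Or A B → (A ∷ Δ) ⊢ C → (B ∷ Δ) ⊢ C → Δ ⊢ C
    impI  : ∀ {A B} → (A ∷ Δ) ⊢ B → Δ ⊢ Imp A B
    impE  : ∀ {A B} → Δ ⊢ Imp A B → Δ ⊢ A → Δ ⊢ B
    allI  : ∀ {σ A} → map wkF Δ ⊢ A → Δ ⊢ All σ A
    allE  : ∀ {σ A} → Δ ⊢ All σ A → (t : Tm Γ σ) → Δ ⊢ A [ t ]
    exI   : ∀ {σ A} (t : Tm Γ σ) → Δ ⊢ A [ t ] → Δ ⊢ Ex σ A
    exE   : ∀ {σ A C} → Δ ⊢ Ex σ A → (A ∷ map wkF Δ) ⊢ wkF C → Δ ⊢ C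

{-# OPTIONS --safe #-}
module Submission where

-- The equivalence is proved by induction on A; the backward directions only forget witnesses.
-- The forward directions need choice and independence of premise, but AC^ω_* and IP^*_∄ only
-- provide finite sets of candidate witnesses. Two facts close the gap. A_HR is monotone in its
-- witnesses for the order that is equality at G, pointwise at function types and inclusion at set
-- types; and every witness type ends in a set type, where the union of a set of candidates,
-- definable from ⋃ and the combinators, majorises each candidate. So a set of candidates can be
-- replaced by one witness, and AC^ω_*, IP^*_∄ become plain choice and independence of premise for
-- monotone formulas. For an implication, choice is applied to the universally quantified premise
-- witnesses one at a time, which produces the Skolem functions with their arguments rotated.

open import Defs
open import Data.List using (List; []; _∷_; _++_; map)
open import Data.List.Membership.Propositional using (_∈_)
open import Data.List.Membership.Propositional.Properties using (∈-map⁺; ∈-map⁻)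
open import Data.List.Relation.Unary.Any using (here; there)
import Data.List.Relation.Unary.All as ListAll
import Data.List.Relation.Unary.All.Properties as ListAllP
open import Data.List.Relation.Binary.Subset.Propositional using (_⊆_)
open import Data.List.Relation.Binary.Subset.Propositional.Properties using (∷⁺ʳ; xs⊆x∷xs)
open import Data.Product using (_,_)
open import Data.Sum using (inj₁; inj₂)
open import Data.Unit using (tt)
open import Data.Vec.Properties using (map-cong; map-∘; map-id)
open import Function using (_∘_)
open import Relation.Binary.PropositionalEquality
  using (_≡_; refl; sym; trans; cong; cong₂; subst; subst₂)

module _ (L : Language) where
  open Language L using (const)
  open Logic L

  infix 4 _≗ₛ_
  _≗ₛ_ : ∀ {Γ Δ} → Sub Γ Δ → Sub Γ Δ → Set
  s ≗ₛ t = ∀ {τ} (v : Var _ τ) → s v ≡ t v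

  infixr 9 _⊙_
  _⊙_ : ∀ {Γ Δ Θ} → Sub Δ Θ → Sub Γ Δ → Sub Γ Θ
  (s ⊙ t) v = subT s (t v)

  subT-cong : ∀ {Γ Δ τ} {s t : Sub Γ Δ} → s ≗ₛ t → (u : Tm Γ τ) → subT s u ≡ subT t u
  subT-cong e (var x)   = e x
  subT-cong e (fn f)    = refl
  subT-cong e Πc        = refl
  subT-cong e Σc        = refl
  subT-cong e sng       = refl
  subT-cong e cup       = refl
  subT-cong e bigcup    = refl
  subT-cong e (app u w) = cong₂ app (subT-cong e u) (subT-cong e w)

  subT-comp : ∀ {Γ Δ Θ τ} (s : Sub Δ Θ) (t : Sub Γ Δ) (u : Tm Γ τ) →
              subT s (subT t u) ≡ subT (s ⊙ t) u
  subT-comp s t (var x)   = refl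
  subT-comp s t (fn f)    = refl
  subT-comp s t Πc        = refl
  subT-comp s t Σc        = refl
  subT-comp s t sng       = refl
  subT-comp s t cup       = refl
  subT-comp s t bigcup    = refl
  subT-comp s t (app u w) = cong₂ app (subT-comp s t u) (subT-comp s t w)

  subT-id : ∀ {Γ τ} (u : Tm Γ τ) → subT var u ≡ u
  subT-id (var x)   = refl
  subT-id (fn f)    = refl
  subT-id Πc        = refl
  subT-id Σc        = refl
  subT-id sng       = refl
  subT-id cup       = refl
  subT-id bigcup    = refl
  subT-id (app u w) = cong₂ app (subT-id u) (subT-id w)

  subT-fuse : ∀ {Γ Δ Θ τ} {s : Sub Δ Θ} {t : Sub Γ Δ} {r : Sub Γ Θ} →
              s ⊙ t ≗ₛ r → (u : Tm Γ τ) → subT s (subT t u) ≡ subT r u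
  subT-fuse {s = s} {t} e u = trans (subT-comp s t u) (subT-cong e u)

  subT-wkT : ∀ {Γ Δ σ τ} (t : Tm Δ σ) (s : Sub Γ Δ) (u : Tm Γ τ) → subT (t ▸ s) (wkT u) ≡ subT s u
  subT-wkT t s = subT-fuse (λ v → refl)

  wkT-inst : ∀ {Γ σ τ} (t : Tm Γ σ) (u : Tm Γ τ) → subT (t ▸ var) (wkT u) ≡ u
  wkT-inst t u = trans (subT-wkT t var u) (subT-id u)

  lift-wkT : ∀ {Γ Δ σ τ} (s : Sub Γ Δ) (u : Tm Γ τ) → subT (lift {σ = σ} s) (wkT u) ≡ wkT (subT s u)
  lift-wkT s u = trans (subT-fuse (λ v → refl) u) (sym (subT-comp (var ∘ vs) s u))

  lift-cong : ∀ {Γ Δ σ} {s t : Sub Γ Δ} → s ≗ₛ t → lift {σ = σ} s ≗ₛ lift t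
  lift-cong e vz     = refl
  lift-cong e (vs v) = cong wkT (e v)

  lift-comp : ∀ {Γ Δ Θ σ} (s : Sub Δ Θ) (t : Sub Γ Δ) → lift {σ = σ} s ⊙ lift t ≗ₛ lift (s ⊙ t)
  lift-comp s t vz     = refl
  lift-comp s t (vs v) = lift-wkT s (t v)

  lift-id : ∀ {Γ σ} → lift {Γ} {Γ} {σ} var ≗ₛ var
  lift-id vz     = refl
  lift-id (vs v) = refl

  subF-cong : ∀ {Γ Δ} {s t : Sub Γ Δ} → s ≗ₛ t → (A : Fm Γ) → subF s A ≡ subF t A
  subF-cong e Bot        = refl
  subF-cong e (Eq t q)   = cong₂ Eq (subT-cong e t) (subT-cong e q)
  subF-cong e (Mem t q)  = cong₂ Mem (subT-cong e t) (subT-cong e q)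
  subF-cong e (R r ts)   = cong (R r) (map-cong (subT-cong e) ts)
  subF-cong e (Or A B)   = cong₂ Or (subF-cong e A) (subF-cong e B)
  subF-cong e (And A B)  = cong₂ And (subF-cong e A) (subF-cong e B)
  subF-cong e (Imp A B)  = cong₂ Imp (subF-cong e A) (subF-cong e B)
  subF-cong e (All σ A)  = cong (All σ) (subF-cong (lift-cong e) A)
  subF-cong e (Ex σ A)   = cong (Ex σ) (subF-cong (lift-cong e) A)
  subF-cong e (BAll t A) = cong₂ BAll (subT-cong e t) (subF-cong (lift-cong e) A)
  subF-cong e (BEx t A)  = cong₂ BEx (subT-cong e t) (subF-cong (lift-cong e) A)

  subF-comp : ∀ {Γ Δ Θ} (s : Sub Δ Θ) (t : Sub Γ Δ) (A : Fm Γ) →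
              subF s (subF t A) ≡ subF (s ⊙ t) A
  subF-comp s t Bot        = refl
  subF-comp s t (Eq u q)   = cong₂ Eq (subT-comp s t u) (subT-comp s t q)
  subF-comp s t (Mem u q)  = cong₂ Mem (subT-comp s t u) (subT-comp s t q)
  subF-comp s t (R r ts)   =
    cong (R r) (trans (sym (map-∘ (subT s) (subT t) ts)) (map-cong (subT-comp s t) ts))
  subF-comp s t (Or A B)   = cong₂ Or (subF-comp s t A) (subF-comp s t B)
  subF-comp s t (And A B)  = cong₂ And (subF-comp s t A) (subF-comp s t B)
  subF-comp s t (Imp A B)  = cong₂ Imp (subF-comp s t A) (subF-comp s t B)
  subF-comp s t (All σ A)  = cong (All σ) (trans (subF-comp (lift s) (lift t) A) (subF-cong (lift-comp s t) A))
  subF-comp s t (Ex σ A)   = cong (Ex σ) (trans (subF-comp (lift s) (lift t) A) (subF-cong (lift-comp s t) A))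
  subF-comp s t (BAll u A) =
    cong₂ BAll (subT-comp s t u) (trans (subF-comp (lift s) (lift t) A) (subF-cong (lift-comp s t) A))
  subF-comp s t (BEx u A)  =
    cong₂ BEx (subT-comp s t u) (trans (subF-comp (lift s) (lift t) A) (subF-cong (lift-comp s t) A))

  subF-id : ∀ {Γ} (A : Fm Γ) → subF var A ≡ A
  subF-id Bot        = refl
  subF-id (Eq t q)   = cong₂ Eq (subT-id t) (subT-id q)
  subF-id (Mem t q)  = cong₂ Mem (subT-id t) (subT-id q)
  subF-id (R r ts)   = cong (R r) (trans (map-cong subT-id ts) (map-id ts))
  subF-id (Or A B)   = cong₂ Or (subF-id A) (subF-id B)
  subF-id (And A B)  = cong₂ And (subF-id A) (subF-id B)
  subF-id (Imp A B)  = cong₂ Imp (subF-id A) (subF-id B)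
  subF-id (All σ A)  = cong (All σ) (trans (subF-cong lift-id A) (subF-id A))
  subF-id (Ex σ A)   = cong (Ex σ) (trans (subF-cong lift-id A) (subF-id A))
  subF-id (BAll t A) = cong₂ BAll (subT-id t) (trans (subF-cong lift-id A) (subF-id A))
  subF-id (BEx t A)  = cong₂ BEx (subT-id t) (trans (subF-cong lift-id A) (subF-id A))

  subF-fuse : ∀ {Γ Δ Θ} {s : Sub Δ Θ} {t : Sub Γ Δ} {r : Sub Γ Θ} →
              s ⊙ t ≗ₛ r → (A : Fm Γ) → subF s (subF t A) ≡ subF r A
  subF-fuse {s = s} {t} e A = trans (subF-comp s t A) (subF-cong e A)

  subF-square : ∀ {Γ Δ Δ′ Θ} {s : Sub Δ Θ} {t : Sub Γ Δ} {s′ : Sub Δ′ Θ} {t′ : Sub Γ Δ′} →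
                s ⊙ t ≗ₛ s′ ⊙ t′ → (A : Fm Γ) → subF s (subF t A) ≡ subF s′ (subF t′ A)
  subF-square e A = trans (subF-fuse e A) (sym (subF-comp _ _ A))

  subF-≗id : ∀ {Γ} {s : Sub Γ Γ} → s ≗ₛ var → (A : Fm Γ) → subF s A ≡ A
  subF-≗id e A = trans (subF-cong e A) (subF-id A)

  subF-fuse-id : ∀ {Γ Δ} {s : Sub Δ Γ} {t : Sub Γ Δ} → s ⊙ t ≗ₛ var → (A : Fm Γ) → subF s (subF t A) ≡ A
  subF-fuse-id e A = trans (subF-fuse e A) (subF-id A)

  lift-wkF : ∀ {Γ Δ σ} (s : Sub Γ Δ) (A : Fm Γ) → subF (lift {σ = σ} s) (wkF A) ≡ wkF (subF s A)
  lift-wkF s = subF-square (λ v → refl)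

  subF-inst : ∀ {Γ Δ σ} (s : Sub Γ Δ) (A : Fm (σ ∷ Γ)) (t : Tm Γ σ) →
              subF s (A [ t ]) ≡ (subF (lift s) A) [ subT s t ]
  subF-inst s A t = subF-square commute A
    where
    commute : s ⊙ (t ▸ var) ≗ₛ (subT s t ▸ var) ⊙ lift s
    commute vz     = refl
    commute (vs v) = sym (wkT-inst (subT s t) (s v))

  inst-vz-lift-wk : ∀ {Γ σ} (A : Fm (σ ∷ Γ)) → (subF (lift (var ∘ vs)) A) [ var vz ] ≡ A
  inst-vz-lift-wk = subF-fuse-id λ { vz → refl ; (vs v) → refl }

  data View {Γ : Ctx} (xs : Ctx) {τ : Ty} : Var (xs ++ Γ) τ → Set where
    left  : (w : Var xs τ) → View xs (inl xs w)
    right : (w : Var Γ τ) → View xs (inr xs w)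

  view : ∀ {Γ τ} (xs : Ctx) (v : Var (xs ++ Γ) τ) → View {Γ} xs v
  view []       v      = right v
  view (x ∷ xs) vz     = left vz
  view (x ∷ xs) (vs v) with view xs v
  ... | left w  = left (vs w)
  ... | right w = right w

  split-inl : ∀ {Γ τ} (xs : Ctx) (w : Var xs τ) → split {Γ} xs (inl xs w) ≡ inj₁ w
  split-inl (x ∷ xs) vz = refl
  split-inl {Γ} (x ∷ xs) (vs w) rewrite split-inl {Γ} xs w = refl

  split-inr : ∀ {Γ τ} (xs : Ctx) (w : Var Γ τ) → split {Γ} xs (inr xs w) ≡ inj₂ w
  split-inr []       w = refl
  split-inr (x ∷ xs) w rewrite split-inr xs w = refl

  glue-inl : ∀ {Γ Δ τ} (xs : Ctx) (f : Sub xs Δ) (g : Sub Γ Δ) (w : Var xs τ) →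
             glue xs f g (inl xs w) ≡ f w
  glue-inl {Γ} xs f g w rewrite split-inl {Γ} xs w = refl

  glue-inr : ∀ {Γ Δ τ} (xs : Ctx) (f : Sub xs Δ) (g : Sub Γ Δ) (w : Var Γ τ) →
             glue xs f g (inr xs w) ≡ g w
  glue-inr xs f g w rewrite split-inr xs w = refl

  glue-vs : ∀ {Γ Δ τ x} (xs : Ctx) (f : Sub (x ∷ xs) Δ) (g : Sub Γ Δ) (v : Var (xs ++ Γ) τ) →
            glue (x ∷ xs) f g (vs v) ≡ glue xs (f ∘ vs) g v
  glue-vs xs f g v with split xs v
  ... | inj₁ w = refl
  ... | inj₂ w = refl

  glue-unique : ∀ {Γ Δ} (xs : Ctx) {s : Sub (xs ++ Γ) Δ} (f : Sub xs Δ) (g : Sub Γ Δ) →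
                (∀ {τ} (w : Var xs τ) → s (inl xs w) ≡ f w) →
                (∀ {τ} (u : Var Γ τ) → s (inr xs u) ≡ g u) → s ≗ₛ glue xs f g
  glue-unique xs f g el er v = by-view v (view xs v)
    where
    by-view : ∀ {τ} (v : Var _ τ) → View xs v → _ ≡ glue xs f g v
    by-view _ (left w)  = trans (el w) (sym (glue-inl xs f g w))
    by-view _ (right u) = trans (er u) (sym (glue-inr xs f g u))

  glue-vars : ∀ {Γ} (xs : Ctx) → glue {Γ} xs (var ∘ inl xs) (var ∘ inr xs) ≗ₛ var
  glue-vars xs v = sym (glue-unique xs {s = var} (var ∘ inl xs) (var ∘ inr xs) (λ _ → refl) (λ _ → refl) v)

  glue-post : ∀ {Γ Δ Θ} (xs : Ctx) (f : Sub xs Δ) (g : Sub Γ Δ) (s : Sub Δ Θ) →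
              s ⊙ glue xs f g ≗ₛ glue xs (subT s ∘ f) (subT s ∘ g)
  glue-post xs f g s =
    glue-unique xs (subT s ∘ f) (subT s ∘ g) (cong (subT s) ∘ glue-inl xs f g) (cong (subT s) ∘ glue-inr xs f g)

  glue-cong : ∀ {Γ Δ} (xs : Ctx) {f f′ : Sub xs Δ} {g g′ : Sub Γ Δ} →
              f ≗ₛ f′ → g ≗ₛ g′ → glue xs f g ≗ₛ glue xs f′ g′
  glue-cong xs {f} {f′} {g} {g′} e e′ =
    glue-unique xs f′ g′ (λ w → trans (glue-inl xs f g w) (e w)) (λ u → trans (glue-inr xs f g u) (e′ u))

  glue-⊙-rename : ∀ {Γ Θ} (xs ys : Ctx) (h : ∀ {τ} → Var ys τ → Var xs τ) (f : Sub xs Θ) (g : Sub Γ Θ) →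
                  glue xs f g ⊙ glue ys (var ∘ inl xs ∘ h) (var ∘ inr xs) ≗ₛ glue ys (f ∘ h) g
  glue-⊙-rename {Γ} xs ys h f g = glue-unique ys {s = glue xs f g ⊙ glue ys ρf ρg} (f ∘ h) g
    (λ w → trans (cong (subT (glue xs f g)) (glue-inl ys ρf ρg w)) (glue-inl xs f g (h w)))
    (λ u → trans (cong (subT (glue xs f g)) (glue-inr ys ρf ρg u)) (glue-inr xs f g u))
    where
    ρf : Sub ys (xs ++ Γ)
    ρf = var ∘ inl xs ∘ h
    ρg : Sub Γ (xs ++ Γ)
    ρg = var ∘ inr xs

  atomic-sub : ∀ {Γ Δ} (s : Sub Γ Δ) {A : Fm Γ} → Atomic A → Atomic (subF s A)
  atomic-sub s at-bot = at-bot
  atomic-sub s at-eq  = at-eq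
  atomic-sub s at-mem = at-mem
  atomic-sub s at-rel = at-rel

  exFree-sub : ∀ {Γ Δ} (s : Sub Γ Δ) (A : Fm Γ) → ExFree A → ExFree (subF s A)
  exFree-sub s Bot        e       = tt
  exFree-sub s (Eq t q)   e       = tt
  exFree-sub s (Mem t q)  e       = tt
  exFree-sub s (R r ts)   e       = tt
  exFree-sub s (Or A B)   (e , f) = exFree-sub s A e , exFree-sub s B f
  exFree-sub s (And A B)  (e , f) = exFree-sub s A e , exFree-sub s B f
  exFree-sub s (Imp A B)  (e , f) = exFree-sub s A e , exFree-sub s B f
  exFree-sub s (All σ A)  e       = exFree-sub (lift s) A e
  exFree-sub s (BAll t A) e       = exFree-sub (lift s) A e
  exFree-sub s (BEx t A)  e       = exFree-sub (lift s) A e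

  Axiom-sub : ∀ {Γ Δ} (s : Sub Γ Δ) {A : Fm Γ} → Axiom A → Axiom (subF s A)
  Axiom-sub s (eq-refl x) = eq-refl (subT s x)
  Axiom-sub s (eq-subst A at x y)
    rewrite subF-inst s A x | subF-inst s A y =
      eq-subst (subF (lift s) A) (atomic-sub (lift s) at) (subT s x) (subT s y)
  Axiom-sub s (ball-def {σ} t A) =
    subst (λ X → Axiom (Iff (BAll (subT s t) (subF (lift s) A)) (All σ (Imp (Mem (var vz) X) (subF (lift s) A)))))
          (sym (lift-wkT s t)) (ball-def (subT s t) (subF (lift s) A))
  Axiom-sub s (bex-def {σ} t A) =
    subst (λ X → Axiom (Iff (BEx (subT s t) (subF (lift s) A)) (Ex σ (And (Mem (var vz) X) (subF (lift s) A)))))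
          (sym (lift-wkT s t)) (bex-def (subT s t) (subF (lift s) A))
  Axiom-sub s (Σ-ax x y z)         = Σ-ax _ _ _
  Axiom-sub s (Π-ax x y)           = Π-ax _ _
  Axiom-sub s (sng-ax w x)         = sng-ax _ _
  Axiom-sub s (cup-ax w x y)       = cup-ax _ _ _
  Axiom-sub s (bigcup-mem z x w y) = bigcup-mem _ _ _ _
  Axiom-sub s (bigcup-sng x y)     = bigcup-sng _ _
  Axiom-sub s (bigcup-cup x y z)   = bigcup-cup _ _ _
  Axiom-sub s (ac {ρ} {σ} A) =
    subst (λ X → Axiom (Imp (All ρ (Ex σ (subF (lift (lift s)) A)))
                            (Ex (ρ ⇒ σ *) (All ρ (BEx (app (var (vs vz)) (var vz)) X)))))
          (sym (subF-square commute A)) (ac (subF (lift (lift s)) A))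
    where
    θ : ∀ {Γ} → Sub (σ ∷ ρ ∷ Γ) (σ ∷ ρ ∷ (ρ ⇒ σ *) ∷ Γ)
    θ = var vz ▸ (var (vs vz) ▸ (var ∘ vs ∘ vs ∘ vs))
    commute : lift (lift (lift s)) ⊙ θ ≗ₛ θ ⊙ lift (lift s)
    commute vz          = refl
    commute (vs vz)     = refl
    commute (vs (vs v)) = trans (subT-comp _ _ (wkT (s v))) (trans (subT-comp _ _ (s v))
                           (sym (trans (subT-comp _ _ (wkT (s v))) (subT-comp _ _ (s v)))))
  Axiom-sub s (ip {σ} B e A) =
    subst₂ (λ X Y → Axiom (Imp (Imp (subF s B) (Ex σ (subF (lift s) A))) (Ex (σ *) (Imp X (BEx (var vz) Y)))))
          (sym (lift-wkF s B)) (sym (subF-square commute A)) (ip (subF s B) (exFree-sub s B e) (subF (lift s) A))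
    where
    θ : ∀ {Γ} → Sub (σ ∷ Γ) (σ ∷ (σ *) ∷ Γ)
    θ = var vz ▸ (var ∘ vs ∘ vs)
    commute : lift (lift s) ⊙ θ ≗ₛ θ ⊙ lift s
    commute vz     = refl
    commute (vs v) = trans (subT-comp _ _ (s v)) (sym (subT-comp _ _ (s v)))

  _⇒ₛ_∣_ : ∀ {Γ Γ′} → List (Fm Γ) → List (Fm Γ′) → Sub Γ Γ′ → Set
  Δ ⇒ₛ Δ′ ∣ s = ∀ {P} → P ∈ Δ → subF s P ∈ Δ′

  ∷-⇒ₛ : ∀ {Γ Γ′} {s : Sub Γ Γ′} {Δ Δ′ A} → Δ ⇒ₛ Δ′ ∣ s → (A ∷ Δ) ⇒ₛ (subF s A ∷ Δ′) ∣ s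
  ∷-⇒ₛ h (here refl) = here refl
  ∷-⇒ₛ h (there p)   = there (h p)

  wkF-⇒ₛ : ∀ {Γ Γ′ σ} {s : Sub Γ Γ′} {Δ Δ′} →
           Δ ⇒ₛ Δ′ ∣ s → map wkF Δ ⇒ₛ map wkF Δ′ ∣ lift {σ = σ} s
  wkF-⇒ₛ {s = s} {Δ′ = Δ′} h p with ∈-map⁻ wkF p
  ... | Q , q , refl = subst (_∈ map wkF Δ′) (sym (lift-wkF s Q)) (∈-map⁺ wkF (h q))

  ⊢-sub : ∀ {Γ Γ′} (s : Sub Γ Γ′) {Δ Δ′} → Δ ⇒ₛ Δ′ ∣ s → ∀ {C} → Δ ⊢ C → Δ′ ⊢ subF s C
  ⊢-sub s h (hyp p)     = hyp (h p)
  ⊢-sub s h (ax a)      = ax (Axiom-sub s a)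
  ⊢-sub s h (botE d)    = botE (⊢-sub s h d)
  ⊢-sub s h (andI d e)  = andI (⊢-sub s h d) (⊢-sub s h e)
  ⊢-sub s h (andE₁ d)   = andE₁ (⊢-sub s h d)
  ⊢-sub s h (andE₂ d)   = andE₂ (⊢-sub s h d)
  ⊢-sub s h (orI₁ d)    = orI₁ (⊢-sub s h d)
  ⊢-sub s h (orI₂ d)    = orI₂ (⊢-sub s h d)
  ⊢-sub s h (orE d e f) = orE (⊢-sub s h d) (⊢-sub s (∷-⇒ₛ h) e) (⊢-sub s (∷-⇒ₛ h) f)
  ⊢-sub s h (impI d)    = impI (⊢-sub s (∷-⇒ₛ h) d)
  ⊢-sub s h (impE d e)  = impE (⊢-sub s h d) (⊢-sub s h e)
  ⊢-sub s h (allI d)    = allI (⊢-sub (lift s) (wkF-⇒ₛ h) d)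
  ⊢-sub s h (allE {A = A} d t) =
    subst (_ ⊢_) (sym (subF-inst s A t)) (allE (⊢-sub s h d) (subT s t))
  ⊢-sub s h (exI {A = A} t d) = exI (subT s t) (subst (_ ⊢_) (subF-inst s A t) (⊢-sub s h d))
  ⊢-sub s h (exE {C = C} d e) =
    exE (⊢-sub s h d) (subst (_ ⊢_) (lift-wkF s C) (⊢-sub (lift s) (∷-⇒ₛ (wkF-⇒ₛ h)) e))

  cast : ∀ {Γ} {Δ : List (Fm Γ)} {A B} → A ≡ B → Δ ⊢ A → Δ ⊢ B
  cast = subst (_ ⊢_)

  ⊢-weaken : ∀ {Γ} {Δ Δ′ : List (Fm Γ)} → Δ ⊆ Δ′ → ∀ {C} → Δ ⊢ C → Δ′ ⊢ C
  ⊢-weaken {Δ′ = Δ′} h {C} d =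
    cast (subF-id C) (⊢-sub var (λ {P} p → subst (_∈ Δ′) (sym (subF-id P)) (h p)) d)

  weaken : ∀ {Γ} {Δ : List (Fm Γ)} {A C} → Δ ⊢ C → (A ∷ Δ) ⊢ C
  weaken = ⊢-weaken there

  ⊢-closed : ∀ {Γ} {Δ : List (Fm Γ)} {C} → [] ⊢ C → Δ ⊢ C
  ⊢-closed = ⊢-weaken (λ ())

  ⊢-wkF : ∀ {Γ σ} {Δ : List (Fm Γ)} {C} → Δ ⊢ C → map (wkF {σ = σ}) Δ ⊢ wkF C
  ⊢-wkF = ⊢-sub (var ∘ vs) (∈-map⁺ wkF)

  cut : ∀ {Γ} {Δ : List (Fm Γ)} {A B} → Δ ⊢ A → (A ∷ Δ) ⊢ B → Δ ⊢ B
  cut d e = impE (impI e) d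

  allE-fresh : ∀ {Γ σ} {Δ : List (Fm Γ)} {A} → Δ ⊢ All σ A → map wkF Δ ⊢ A
  allE-fresh {A = A} d = cast (inst-vz-lift-wk A) (allE (⊢-wkF d) (var vz))

  allE-vz : ∀ {Γ σ} {Δ : List (Fm (σ ∷ Γ))} {A} → Δ ⊢ wkF (All σ A) → Δ ⊢ A
  allE-vz {A = A} d = cast (inst-vz-lift-wk A) (allE d (var vz))

  exI-vz : ∀ {Γ σ} {Δ : List (Fm (σ ∷ Γ))} {A} → Δ ⊢ A → Δ ⊢ wkF (Ex σ A)
  exI-vz {A = A} d = exI (var vz) (cast (sym (inst-vz-lift-wk A)) d)

  ex-map : ∀ {Γ σ} {Δ : List (Fm Γ)} {A B} → (A ∷ map wkF Δ) ⊢ B → Δ ⊢ Ex σ A → Δ ⊢ Ex σ B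
  ex-map e d = exE d (exI-vz e)

  Eq-subst : ∀ {Γ ρ} {Δ : List (Fm Γ)} (A : Fm (ρ ∷ Γ)) → Atomic A → {x y : Tm Γ ρ} →
             Δ ⊢ Eq x y → Δ ⊢ A [ x ] → Δ ⊢ A [ y ]
  Eq-subst A at {x} {y} e d = impE (ax (eq-subst A at x y)) (andI e d)

  Eq-refl : ∀ {Γ ρ} {Δ : List (Fm Γ)} (x : Tm Γ ρ) → Δ ⊢ Eq x x
  Eq-refl x = ax (eq-refl x)

  Eq-sym : ∀ {Γ ρ} {Δ : List (Fm Γ)} {x y : Tm Γ ρ} → Δ ⊢ Eq x y → Δ ⊢ Eq y x
  Eq-sym {x = x} {y} e =
    subst (λ z → _ ⊢ Eq y z) (wkT-inst y x)
      (Eq-subst (Eq (var vz) (wkT x)) at-eq e (subst (λ z → _ ⊢ Eq x z) (sym (wkT-inst x x)) (Eq-refl x)))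

  Eq-trans : ∀ {Γ ρ} {Δ : List (Fm Γ)} {x y z : Tm Γ ρ} → Δ ⊢ Eq x y → Δ ⊢ Eq y z → Δ ⊢ Eq x z
  Eq-trans {x = x} {y} {z} e f =
    subst (λ w → _ ⊢ Eq w z) (wkT-inst z x)
      (Eq-subst (Eq (wkT x) (var vz)) at-eq f (subst (λ w → _ ⊢ Eq w y) (sym (wkT-inst y x)) e))

  Eq-appʳ : ∀ {Γ σ τ} {Δ : List (Fm Γ)} (f : Tm Γ (σ ⇒ τ)) {x y : Tm Γ σ} →
            Δ ⊢ Eq x y → Δ ⊢ Eq (app f x) (app f y)
  Eq-appʳ f {x} {y} e =
    subst₂ (λ a b → _ ⊢ Eq (app a b) (app a y)) (wkT-inst y f) (wkT-inst y x)
      (Eq-subst (Eq (app (wkT f) (wkT x)) (app (wkT f) (var vz))) at-eq e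
        (subst₂ (λ a b → _ ⊢ Eq (app a b) (app a x)) (sym (wkT-inst x f)) (sym (wkT-inst x x))
          (Eq-refl (app f x))))

  Eq-appˡ : ∀ {Γ σ τ} {Δ : List (Fm Γ)} {f g : Tm Γ (σ ⇒ τ)} (x : Tm Γ σ) →
            Δ ⊢ Eq f g → Δ ⊢ Eq (app f x) (app g x)
  Eq-appˡ {f = f} {g} x e =
    subst₂ (λ a b → _ ⊢ Eq (app a b) (app g b)) (wkT-inst g f) (wkT-inst g x)
      (Eq-subst (Eq (app (wkT f) (wkT x)) (app (var vz) (wkT x))) at-eq e
        (subst₂ (λ a b → _ ⊢ Eq (app a b) (app f b)) (sym (wkT-inst f f)) (sym (wkT-inst f x))
          (Eq-refl (app f x))))

  Eq-app : ∀ {Γ σ τ} {Δ : List (Fm Γ)} {f g : Tm Γ (σ ⇒ τ)} {x y : Tm Γ σ} →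
           Δ ⊢ Eq f g → Δ ⊢ Eq x y → Δ ⊢ Eq (app f x) (app g y)
  Eq-app {g = g} {x} e f = Eq-trans (Eq-appˡ x e) (Eq-appʳ g f)

  Mem-congʳ : ∀ {Γ ρ} {Δ : List (Fm Γ)} {w : Tm Γ ρ} {S S′} → Δ ⊢ Eq S S′ → Δ ⊢ Mem w S → Δ ⊢ Mem w S′
  Mem-congʳ {w = w} {S} {S′} e d =
    subst (λ a → _ ⊢ Mem a S′) (wkT-inst S′ w)
      (Eq-subst (Mem (wkT w) (var vz)) at-mem e (subst (λ a → _ ⊢ Mem a S) (sym (wkT-inst S w)) d))

  Mem-sng : ∀ {Γ σ} {Δ : List (Fm Γ)} (w : Tm Γ σ) → Δ ⊢ Mem w (app sng w)
  Mem-sng w = impE (andE₂ (ax (sng-ax w w))) (Eq-refl w)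

  bexI : ∀ {Γ σ} {Δ : List (Fm Γ)} {S : Tm Γ (σ *)} {A : Fm (σ ∷ Γ)} (t : Tm Γ σ) →
         Δ ⊢ Mem t S → Δ ⊢ A [ t ] → Δ ⊢ BEx S A
  bexI {S = S} {A} t m d =
    impE (andE₂ (ax (bex-def S A))) (exI t (andI (subst (λ a → _ ⊢ Mem t a) (sym (wkT-inst t S)) m) d))

  bexE : ∀ {Γ σ} {Δ : List (Fm Γ)} {S : Tm Γ (σ *)} {A : Fm (σ ∷ Γ)} {C} →
         Δ ⊢ BEx S A → (A ∷ Mem (var vz) (wkT S) ∷ map wkF Δ) ⊢ wkF C → Δ ⊢ C
  bexE {S = S} {A} d e =
    exE (impE (andE₁ (ax (bex-def S A))) d)
      (cut (andE₁ (hyp (here refl)))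
        (cut (andE₂ (hyp (there (here refl)))) (⊢-weaken (∷⁺ʳ _ (∷⁺ʳ _ (xs⊆x∷xs _ _))) e)))

  ballI : ∀ {Γ σ} {Δ : List (Fm Γ)} {S : Tm Γ (σ *)} {A : Fm (σ ∷ Γ)} →
          (Mem (var vz) (wkT S) ∷ map wkF Δ) ⊢ A → Δ ⊢ BAll S A
  ballI {S = S} {A} d = impE (andE₂ (ax (ball-def S A))) (allI (impI d))

  ballE-fresh : ∀ {Γ σ} {Δ : List (Fm Γ)} {S : Tm Γ (σ *)} {A : Fm (σ ∷ Γ)} →
                Δ ⊢ BAll S A → (Mem (var vz) (wkT S) ∷ map wkF Δ) ⊢ A
  ballE-fresh {S = S} {A} d = impE (weaken (allE-fresh (impE (andE₁ (ax (ball-def S A))) d))) (hyp (here refl))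

  wkNT : ∀ {Γ τ} (xs : Ctx) → Tm Γ τ → Tm (xs ++ Γ) τ
  wkNT xs = subT (var ∘ inr xs)

  wkN : ∀ {Γ} (xs : Ctx) → Fm Γ → Fm (xs ++ Γ)
  wkN xs = subF (var ∘ inr xs)

  wkN-∷ : ∀ {Γ} x (xs : Ctx) (A : Fm Γ) → wkF {σ = x} (wkN xs A) ≡ wkN (x ∷ xs) A
  wkN-∷ x xs = subF-fuse (λ v → refl)

  wkN-[] : ∀ {Γ} (A : Fm Γ) → wkN [] A ≡ A
  wkN-[] = subF-id

  wkN-glue : ∀ {Γ Δ} (xs : Ctx) (f : Sub xs Δ) (g : Sub Γ Δ) (P : Fm Γ) →
             subF (glue xs f g) (wkN xs P) ≡ subF g P
  wkN-glue xs f g = subF-fuse (glue-inr xs f g)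

  wkNT-glue : ∀ {Γ Θ τ} (a : Ctx) (f : Sub a Θ) (g : Sub Γ Θ) (t : Tm Γ τ) →
              subT (glue a f g) (wkNT a t) ≡ subT g t
  wkNT-glue a f g = subT-fuse (glue-inr a f g)

  liftN : ∀ {Γ Δ} (xs : Ctx) → Sub Γ Δ → Sub (xs ++ Γ) (xs ++ Δ)
  liftN xs s = glue xs (var ∘ inl xs) (wkNT xs ∘ s)

  liftN-inl : ∀ {Γ Δ τ} (xs : Ctx) (s : Sub Γ Δ) (w : Var xs τ) → liftN xs s (inl xs w) ≡ var (inl xs w)
  liftN-inl xs s = glue-inl xs (var ∘ inl xs) (wkNT xs ∘ s)

  liftN-inr : ∀ {Γ Δ τ} (xs : Ctx) (s : Sub Γ Δ) (u : Var Γ τ) → liftN xs s (inr xs u) ≡ wkNT xs (s u)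
  liftN-inr xs s = glue-inr xs (var ∘ inl xs) (wkNT xs ∘ s)

  lift-liftN : ∀ {Γ Δ} x (xs : Ctx) (s : Sub Γ Δ) → lift {σ = x} (liftN xs s) ≗ₛ liftN (x ∷ xs) s
  lift-liftN x xs s vz     = refl
  lift-liftN x xs s (vs v) = trans (glue-unique xs vs-inl (wkNT (x ∷ xs) ∘ s)
      (λ w → cong wkT (liftN-inl xs s w))
      (λ u → trans (cong wkT (liftN-inr xs s u)) (subT-fuse (λ v → refl) (s u))) v)
    (sym (glue-vs xs (var ∘ inl (x ∷ xs)) (wkNT (x ∷ xs) ∘ s) v))
    where
    vs-inl : Sub xs (x ∷ xs ++ _)
    vs-inl = var ∘ inl (x ∷ xs) ∘ vs

  glue-⊙-liftN : ∀ {Γ Δ Θ} (xs : Ctx) (f : Sub xs Θ) (g : Sub Δ Θ) (s : Sub Γ Δ) →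
                 glue xs f g ⊙ liftN xs s ≗ₛ glue xs f (g ⊙ s)
  glue-⊙-liftN xs f g s = glue-unique xs f (g ⊙ s)
    (λ w → trans (cong (subT (glue xs f g)) (liftN-inl xs s w)) (glue-inl xs f g w))
    (λ u → trans (cong (subT (glue xs f g)) (liftN-inr xs s u)) (subT-fuse (glue-inr xs f g) (s u)))

  exN-sub : ∀ {Γ Δ} (xs : Ctx) (s : Sub Γ Δ) (P : Fm (xs ++ Γ)) →
            subF s (exN xs P) ≡ exN xs (subF (liftN xs s) P)
  exN-sub []       s P = sym (subF-cong (subT-id ∘ s) P)
  exN-sub (x ∷ xs) s P =
    trans (exN-sub xs s (Ex x P)) (cong (exN xs ∘ Ex x) (subF-cong (lift-liftN x xs s) P))

  allN-sub : ∀ {Γ Δ} (xs : Ctx) (s : Sub Γ Δ) (P : Fm (xs ++ Γ)) →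
             subF s (allN xs P) ≡ allN xs (subF (liftN xs s) P)
  allN-sub []       s P = sym (subF-cong (subT-id ∘ s) P)
  allN-sub (x ∷ xs) s P =
    trans (allN-sub xs s (All x P)) (cong (allN xs ∘ All x) (subF-cong (lift-liftN x xs s) P))

  inst-glue : ∀ {Γ x} (xs : Ctx) (f : Sub (x ∷ xs) Γ) (P : Fm (x ∷ xs ++ Γ)) →
              (subF (lift (glue xs (f ∘ vs) var)) P) [ f vz ] ≡ subF (glue (x ∷ xs) f var) P
  inst-glue xs f = subF-fuse λ
    { vz     → refl
    ; (vs v) → trans (wkT-inst (f vz) (glue xs (f ∘ vs) var v)) (sym (glue-vs xs f var v)) }

  exNI : ∀ {Γ} {Δ : List (Fm Γ)} (xs : Ctx) {P : Fm (xs ++ Γ)} (f : Sub xs Γ) →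
         Δ ⊢ subF (glue xs f var) P → Δ ⊢ exN xs P
  exNI []       {P} f d = cast (subF-id P) d
  exNI (x ∷ xs) {P} f d = exNI xs (f ∘ vs) (exI (f vz) (cast (sym (inst-glue xs f P)) d))

  allNE : ∀ {Γ} {Δ : List (Fm Γ)} (xs : Ctx) {P : Fm (xs ++ Γ)} →
          Δ ⊢ allN xs P → (f : Sub xs Γ) → Δ ⊢ subF (glue xs f var) P
  allNE []       {P} d f = cast (sym (subF-id P)) d
  allNE (x ∷ xs) {P} d f = cast (inst-glue xs f P) (allE (allNE xs d (f ∘ vs)) (f vz))

  map-wkN-⊆ : ∀ {Γ} x (xs : Ctx) {Δ : List (Fm Γ)} → map (wkN (x ∷ xs)) Δ ⊆ map wkF (map (wkN xs) Δ)
  map-wkN-⊆ x xs {Δ} q with ∈-map⁻ (wkN (x ∷ xs)) q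
  ... | Q , r , refl = subst (_∈ map wkF (map (wkN xs) Δ)) (wkN-∷ x xs Q) (∈-map⁺ wkF (∈-map⁺ (wkN xs) r))

  map-wkN-[]-⊆ : ∀ {Γ} {Δ : List (Fm Γ)} → map (wkN []) Δ ⊆ Δ
  map-wkN-[]-⊆ {Δ = Δ} q with ∈-map⁻ (wkN []) q
  ... | Q , r , refl = subst (_∈ Δ) (sym (wkN-[] Q)) r

  exNE : ∀ {Γ} {Δ : List (Fm Γ)} (xs : Ctx) {P : Fm (xs ++ Γ)} {C} →
         Δ ⊢ exN xs P → (P ∷ map (wkN xs) Δ) ⊢ wkN xs C → Δ ⊢ C
  exNE []       {P} {C} d e = cut d (cast (wkN-[] C) (⊢-weaken (∷⁺ʳ P map-wkN-[]-⊆) e))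
  exNE (x ∷ xs) {P} {C} d e =
    exNE xs d (exE (hyp (here refl)) (cast (sym (wkN-∷ x xs C)) (⊢-weaken (∷⁺ʳ P (there ∘ map-wkN-⊆ x xs)) e)))

  allNI : ∀ {Γ} {Δ : List (Fm Γ)} (xs : Ctx) {P : Fm (xs ++ Γ)} → map (wkN xs) Δ ⊢ P → Δ ⊢ allN xs P
  allNI []       d = ⊢-weaken map-wkN-[]-⊆ d
  allNI (x ∷ xs) d = allNI xs (allI (⊢-weaken (map-wkN-⊆ x xs) d))

  exNI-sub : ∀ {Γ Θ} {Δ : List (Fm Θ)} (xs : Ctx) {P : Fm (xs ++ Γ)} (f : Sub xs Θ) (s : Sub Γ Θ) →
             Δ ⊢ subF (glue xs f s) P → Δ ⊢ subF s (exN xs P)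
  exNI-sub xs {P} f s d =
    cast (sym (exN-sub xs s P))
      (exNI xs f (cast (sym (subF-fuse (λ v → trans (glue-⊙-liftN xs f var s v)
                                                    (glue-cong xs {f = f} (λ _ → refl) (subT-id ∘ s) v)) P)) d))

  exNI-vars : ∀ {Γ} (xs : Ctx) {Δ : List (Fm (xs ++ Γ))} {P} → Δ ⊢ P → Δ ⊢ wkN xs (exN xs P)
  exNI-vars xs {P = P} d = exNI-sub xs (var ∘ inl xs) (var ∘ inr xs) (cast (sym (subF-≗id (glue-vars xs) P)) d)

  allNE-vars : ∀ {Γ} (xs : Ctx) {Δ : List (Fm Γ)} {P} → Δ ⊢ allN xs P → map (wkN xs) Δ ⊢ P
  allNE-vars xs {P = P} d =
    cast (subF-fuse-id (λ v → trans (glue-⊙-liftN xs (var ∘ inl xs) var (var ∘ inr xs) v) (glue-vars xs v)) P)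
      (allNE xs (cast (allN-sub xs (var ∘ inr xs) P) (⊢-sub (var ∘ inr xs) (∈-map⁺ (wkN xs)) d)) (var ∘ inl xs))

  exN-map : ∀ {Γ} (xs : Ctx) {Δ : List (Fm Γ)} {P Q} → (P ∷ map (wkN xs) Δ) ⊢ Q → Δ ⊢ exN xs P → Δ ⊢ exN xs Q
  exN-map xs e d = exNE xs d (exNI-vars xs e)

  allN-map : ∀ {Γ} (xs : Ctx) {Δ : List (Fm Γ)} {P Q} → (P ∷ map (wkN xs) Δ) ⊢ Q → Δ ⊢ allN xs P → Δ ⊢ allN xs Q
  allN-map xs e d = allNI xs (cut (allNE-vars xs d) e)

  appVars-sub : ∀ {Γ Δ τ} (xs : Ctx) (s : Sub Γ Δ) (t : Tm Γ (arrows xs τ)) (h : Sub xs Γ) →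
                subT s (appVars xs t h) ≡ appVars xs (subT s t) (s ⊙ h)
  appVars-sub []       s t h = refl
  appVars-sub (x ∷ xs) s t h = appVars-sub xs s (app t (h vz)) (h ∘ vs)

  appVars-cong : ∀ {Γ τ} (xs : Ctx) {t t′ : Tm Γ (arrows xs τ)} {h h′ : Sub xs Γ} →
                 t ≡ t′ → h ≗ₛ h′ → appVars xs t h ≡ appVars xs t′ h′
  appVars-cong []       e e′ = e
  appVars-cong (x ∷ xs) e e′ = appVars-cong xs (cong₂ app e (e′ vz)) (e′ ∘ vs)

  -- Combinatory completeness

  inhabitant : ∀ {Γ} τ → Tm Γ τ
  inhabitant G       = fn const
  inhabitant (σ ⇒ τ) = app Πc (inhabitant τ)
  inhabitant (σ *)   = app sng (inhabitant σ)

  inhabitants : ∀ {xs Γ} → Sub xs Γ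
  inhabitants {τ = τ} _ = inhabitant τ

  Iᶜ : ∀ {Γ σ} → Tm Γ (σ ⇒ σ)
  Iᶜ {σ = σ} = app (app (Σc {ρ = σ} {σ = σ ⇒ σ} {τ = σ}) Πc) Πc

  Iᶜ-β : ∀ {Γ σ} {Δ : List (Fm Γ)} (u : Tm Γ σ) → Δ ⊢ Eq (app Iᶜ u) u
  Iᶜ-β u = Eq-trans (ax (Σ-ax Πc Πc u)) (ax (Π-ax u (app Πc u)))

  abs : ∀ {Γ σ τ} → Tm (σ ∷ Γ) τ → Tm Γ (σ ⇒ τ)
  abs (var vz)     = Iᶜ
  abs (var (vs x)) = app Πc (var x)
  abs (fn f)       = app Πc (fn f)
  abs Πc           = app Πc Πc
  abs Σc           = app Πc Σc
  abs sng          = app Πc sng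
  abs cup          = app Πc cup
  abs bigcup       = app Πc bigcup
  abs (app t u)    = app (app Σc (abs t)) (abs u)

  abs-β : ∀ {Γ Γ′ σ τ} {Δ : List (Fm Γ′)} (s : Sub Γ Γ′) (t : Tm (σ ∷ Γ) τ) (u : Tm Γ′ σ) →
          Δ ⊢ Eq (app (subT s (abs t)) u) (subT (u ▸ s) t)
  abs-β s (var vz)     u = Iᶜ-β u
  abs-β s (var (vs x)) u = ax (Π-ax _ _)
  abs-β s (fn f)       u = ax (Π-ax _ _)
  abs-β s Πc           u = ax (Π-ax _ _)
  abs-β s Σc           u = ax (Π-ax _ _)
  abs-β s sng          u = ax (Π-ax _ _)
  abs-β s cup          u = ax (Π-ax _ _)
  abs-β s bigcup       u = ax (Π-ax _ _)
  abs-β s (app t w)    u = Eq-trans (ax (Σ-ax _ _ _)) (Eq-app (abs-β s t u) (abs-β s w u))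

  ∅ₛ : ∀ {Γ} → Sub [] Γ
  ∅ₛ ()

  closed : ∀ {Γ τ} → Tm [] τ → Tm Γ τ
  closed = subT ∅ₛ

  subT-closed : ∀ {Γ Δ τ} (s : Sub Γ Δ) (t : Tm [] τ) → subT s (closed t) ≡ closed t
  subT-closed s = subT-fuse λ ()

  -- Majorisation and suprema

  Le : ∀ {Γ} τ → Tm Γ τ → Tm Γ τ → Fm Γ
  Le G       a b = Eq a b
  Le (σ ⇒ τ) a b = All σ (Le τ (app (wkT a) (var vz)) (app (wkT b) (var vz)))
  Le (τ *)   a b = All τ (Imp (Mem (var vz) (wkT a)) (Mem (var vz) (wkT b)))

  Le-sub : ∀ {Γ Δ} τ (s : Sub Γ Δ) (a b : Tm Γ τ) → subF s (Le τ a b) ≡ Le τ (subT s a) (subT s b)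
  Le-sub G       s a b = refl
  Le-sub (σ ⇒ τ) s a b = cong (All σ) (trans (Le-sub τ (lift s) _ _)
    (cong₂ (λ x y → Le τ (app x (var vz)) (app y (var vz))) (lift-wkT s a) (lift-wkT s b)))
  Le-sub (τ *)   s a b =
    cong (All τ) (cong₂ (λ x y → Imp (Mem (var vz) x) (Mem (var vz) y)) (lift-wkT s a) (lift-wkT s b))

  ⊢-Le-sub : ∀ {Γ Γ′} (s : Sub Γ Γ′) {Δ Δ′} → Δ ⇒ₛ Δ′ ∣ s →
             ∀ {τ a b} → Δ ⊢ Le τ a b → Δ′ ⊢ Le τ (subT s a) (subT s b)
  ⊢-Le-sub s h {τ} {a} {b} d = cast (Le-sub τ s a b) (⊢-sub s h d)

  Le-wk : ∀ {Γ σ} {Δ : List (Fm Γ)} {τ a b} → Δ ⊢ Le τ a b → map (wkF {σ = σ}) Δ ⊢ Le τ (wkT a) (wkT b)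
  Le-wk = ⊢-Le-sub (var ∘ vs) (∈-map⁺ wkF)

  Le-refl : ∀ {Γ} {Δ : List (Fm Γ)} τ (a : Tm Γ τ) → Δ ⊢ Le τ a a
  Le-refl G       a = Eq-refl a
  Le-refl (σ ⇒ τ) a = allI (Le-refl τ _)
  Le-refl (τ *)   a = allI (impI (hyp (here refl)))

  Le-app : ∀ {Γ σ τ} {Δ : List (Fm Γ)} {a b : Tm Γ (σ ⇒ τ)} →
           Δ ⊢ Le (σ ⇒ τ) a b → (t : Tm Γ σ) → Δ ⊢ Le τ (app a t) (app b t)
  Le-app {τ = τ} {a = a} {b} d t =
    cast (trans (Le-sub τ (t ▸ var) _ _) (cong₂ (λ x y → Le τ (app x t) (app y t)) (wkT-inst t a) (wkT-inst t b)))
      (allE d t)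

  Le-appVars : ∀ {Γ τ} {Δ : List (Fm Γ)} (xs : Ctx) {F₁ F₂ : Tm Γ (arrows xs τ)} →
               Δ ⊢ Le (arrows xs τ) F₁ F₂ → (h : Sub xs Γ) → Δ ⊢ Le τ (appVars xs F₁ h) (appVars xs F₂ h)
  Le-appVars []       d h = d
  Le-appVars (x ∷ xs) d h = Le-appVars xs (Le-app d (h vz)) (h ∘ vs)

  Le-mem : ∀ {Γ τ} {Δ : List (Fm Γ)} {a b : Tm Γ (τ *)} {w} → Δ ⊢ Le (τ *) a b → Δ ⊢ Mem w a → Δ ⊢ Mem w b
  Le-mem {a = a} {b} {w} d m =
    subst (λ x → _ ⊢ Mem w x) (wkT-inst w b)
      (impE (allE d w) (subst (λ x → _ ⊢ Mem w x) (sym (wkT-inst w a)) m))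

  Le-Eq : ∀ {Γ} {Δ : List (Fm Γ)} τ {a b b′ : Tm Γ τ} → Δ ⊢ Le τ a b → Δ ⊢ Eq b b′ → Δ ⊢ Le τ a b′
  Le-Eq G       d e = Eq-trans d e
  Le-Eq (σ ⇒ τ) d e = allI (Le-Eq τ (allE-fresh d) (Eq-appˡ (var vz) (⊢-wkF e)))
  Le-Eq (τ *)   d e =
    allI (impI (Mem-congʳ (weaken (⊢-wkF e)) (impE (weaken (allE-fresh d)) (hyp (here refl)))))

  data StarEnding : Ty → Set where
    _*  : ∀ τ → StarEnding (τ *)
    _⇒_ : ∀ σ {τ} → StarEnding τ → StarEnding (σ ⇒ τ)

  -- sup S = ⋃_{z ∈ S} z at a set type, and λy. sup {f y | f ∈ S} at a function type.
  sup : ∀ {τ} → StarEnding τ → Tm [] (τ * ⇒ τ)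
  sup (σ *)   = abs (app (app bigcup (var vz)) Iᶜ)
  sup (σ ⇒ p) =
    abs (abs (app (closed (sup p)) (app (app bigcup (var (vs vz))) (abs (app sng (app (var vz) (var (vs vz))))))))

  supT : ∀ {Γ τ} → StarEnding τ → Tm Γ (τ *) → Tm Γ τ
  supT p S = app (closed (sup p)) S

  supT-wk : ∀ {Γ σ τ} (p : StarEnding τ) (S : Tm Γ (τ *)) → wkT {σ = σ} (supT p S) ≡ supT p (wkT S)
  supT-wk p S = cong (λ z → app z (wkT S)) (subT-closed (var ∘ vs) (sup p))

  Le-sup : ∀ {Γ τ} {Δ : List (Fm Γ)} (p : StarEnding τ) {x S} → Δ ⊢ Mem x S → Δ ⊢ Le τ x (supT p S)
  Le-sup {Δ = Δ} (σ *) {x} {S} m =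
    allI (impI (subst (λ z → (Mem (var vz) (wkT x) ∷ map wkF Δ) ⊢ Mem (var vz) (app z (wkT S)))
                      (sym (subT-closed (var ∘ vs) (sup (σ *))))
      (Mem-congʳ (Eq-sym (abs-β ∅ₛ (app (app bigcup (var vz)) Iᶜ) (wkT S)))
        (impE (ax (bigcup-mem (wkT x) (wkT S) (var vz) Iᶜ))
          (andI (weaken (⊢-wkF m)) (Mem-congʳ (Eq-sym (Iᶜ-β (wkT x))) (hyp (here refl))))))))
  Le-sup {Γ} {Δ = Δ} (σ ⇒ p) {x} {S} m = allI (Le-Eq _ (Le-sup p x′y∈⋃) (Eq-sym unfold-sup))
    where
    y  = var {σ ∷ Γ} vz
    S′ = wkT {σ = σ} S
    x′ = wkT {σ = σ} x
    ev : Tm (_ ∷ σ ∷ _ ∷ []) _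
    ev = app sng (app (var vz) (var (vs vz)))
    body : Tm (σ ∷ _ ∷ []) _
    body = app (closed (sup p)) (app (app bigcup (var (vs vz))) (abs ev))
    evy = subT (y ▸ (S′ ▸ ∅ₛ)) (abs ev)
    x′y∈⋃ : map wkF Δ ⊢ Mem (app x′ y) (app (app bigcup S′) evy)
    x′y∈⋃ = impE (ax (bigcup-mem x′ S′ (app x′ y) evy))
                 (andI (⊢-wkF m) (Mem-congʳ (Eq-sym (abs-β (y ▸ (S′ ▸ ∅ₛ)) ev x′)) (Mem-sng (app x′ y))))
    unfold-sup : map wkF Δ ⊢ Eq (app (wkT (supT (σ ⇒ p) S)) y) (supT p (app (app bigcup S′) evy))
    unfold-sup =
      subst (λ z → map wkF Δ ⊢ Eq (app (app z S′) y) (supT p (app (app bigcup S′) evy)))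
            (sym (subT-closed (var ∘ vs) (sup (σ ⇒ p))))
        (Eq-trans (Eq-appˡ y (abs-β ∅ₛ (abs body) S′))
          (subst (λ z → map wkF Δ ⊢ Eq (app (subT (S′ ▸ ∅ₛ) (abs body)) y) (app z (app (app bigcup S′) evy)))
            (subT-closed (y ▸ (S′ ▸ ∅ₛ)) (sup p)) (abs-β (S′ ▸ ∅ₛ) body y)))

  image : ∀ {Γ σ τ} → Tm Γ (σ *) → Tm Γ (σ ⇒ τ) → Tm Γ (τ *)
  image S X = app (app bigcup S) (app (app Σc (app Πc sng)) X)

  Mem-image : ∀ {Γ σ τ} {Δ : List (Fm Γ)} {S : Tm Γ (σ *)} (X : Tm Γ (σ ⇒ τ)) {z} →
              Δ ⊢ Mem z S → Δ ⊢ Mem (app X z) (image S X)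
  Mem-image {S = S} X {z} m =
    impE (ax (bigcup-mem z S (app X z) _))
      (andI m (Mem-congʳ (Eq-sym (Eq-trans (ax (Σ-ax _ _ _)) (Eq-appˡ (app X z) (ax (Π-ax _ _)))))
                         (Mem-sng (app X z))))

  arrows-StarEnding : ∀ {σ} (a : Ctx) → StarEnding σ → StarEnding (arrows a σ)
  arrows-StarEnding []      p = p
  arrows-StarEnding (x ∷ a) p = x ⇒ arrows-StarEnding a p

  wt-StarEnding : ∀ {Γ} (A : Fm Γ) → ListAll.All StarEnding (wt A)
  wt-StarEnding Bot        = ListAll.[]
  wt-StarEnding (Eq t q)   = ListAll.[]
  wt-StarEnding (Mem t q)  = ListAll.[]
  wt-StarEnding (R r ts)   = ListAll.[]
  wt-StarEnding (Or A B)   = ListAllP.++⁺ (wt-StarEnding A) (wt-StarEnding B)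
  wt-StarEnding (And A B)  = ListAllP.++⁺ (wt-StarEnding A) (wt-StarEnding B)
  wt-StarEnding (Imp A B)  = ListAllP.map⁺ (ListAll.map (arrows-StarEnding (wt A)) (wt-StarEnding B))
  wt-StarEnding (All σ A)  = ListAllP.map⁺ (ListAll.map (σ ⇒_) (wt-StarEnding A))
  wt-StarEnding (Ex σ A)   = (σ *) ListAll.∷ wt-StarEnding A
  wt-StarEnding (BAll t A) = wt-StarEnding A
  wt-StarEnding (BEx t A)  = wt-StarEnding A

  lookupVar : ∀ {P : Ty → Set} {xs τ} → ListAll.All P xs → Var xs τ → P τ
  lookupVar (p ListAll.∷ ps) vz     = p
  lookupVar (p ListAll.∷ ps) (vs v) = lookupVar ps v

  pairˡ : ∀ {Γ} (a b : Ctx) → Sub (a ++ Γ) ((a ++ b) ++ Γ)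
  pairˡ a b = glue a (var ∘ inl (a ++ b) ∘ inl a) (var ∘ inr (a ++ b))

  pairʳ : ∀ {Γ} (a b : Ctx) → Sub (b ++ Γ) ((a ++ b) ++ Γ)
  pairʳ a b = glue b (var ∘ inl (a ++ b) ∘ inr a) (var ∘ inr (a ++ b))

  bound-sub : ∀ {Γ σ} (a : Ctx) → Sub (a ++ σ ∷ Γ) (σ ∷ a ++ Γ)
  bound-sub a = glue a (var ∘ vs ∘ inl a) (var vz ▸ (var ∘ vs ∘ inr a))

  witness-sub : ∀ {Γ σ} (a : Ctx) → Sub (a ++ σ ∷ Γ) (σ ∷ (σ *) ∷ a ++ Γ)
  witness-sub a = glue a (var ∘ vs ∘ vs ∘ inl a) (var vz ▸ (var ∘ vs ∘ vs ∘ inr a))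

  lift-glue-⊙-bound : ∀ {Γ Θ σ} (a : Ctx) (f : Sub a Θ) (g : Sub Γ Θ) →
                      lift (glue a f g) ⊙ bound-sub a ≗ₛ glue {σ ∷ Γ} a (wkT ∘ f) (var vz ▸ (wkT ∘ g))
  lift-glue-⊙-bound {Γ} {σ = σ} a f g =
    glue-unique a {s = lift (glue a f g) ⊙ bound-sub a} (wkT ∘ f) (var vz ▸ (wkT ∘ g))
    (λ w → trans (cong (subT (lift (glue a f g))) (glue-inl a ρf ρg w)) (cong wkT (glue-inl a f g w)))
    λ { vz     → cong (subT (lift (glue a f g))) (glue-inr a ρf ρg vz)
      ; (vs u) → trans (cong (subT (lift (glue a f g))) (glue-inr a ρf ρg (vs u))) (cong wkT (glue-inr a f g u)) }
    where
    ρf : Sub a (σ ∷ a ++ Γ)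
    ρf = var ∘ vs ∘ inl a
    ρg : Sub (σ ∷ Γ) (σ ∷ a ++ Γ)
    ρg = var vz ▸ (var ∘ vs ∘ inr a)

  lift-glue-⊙-witness : ∀ {Γ Θ} (σ : Ty) (a : Ctx) (f : Sub ((σ *) ∷ a) Θ) (g : Sub Γ Θ) →
                        lift (glue ((σ *) ∷ a) f g) ⊙ witness-sub a
                          ≗ₛ glue {σ ∷ Γ} a (wkT ∘ f ∘ vs) (var vz ▸ (wkT ∘ g))
  lift-glue-⊙-witness {Γ} σ a f g =
    glue-unique a {s = lift W ⊙ witness-sub a} (wkT ∘ f ∘ vs) (var vz ▸ (wkT ∘ g))
    (λ w → trans (cong (subT (lift W)) (glue-inl a ρf ρg w))
                 (cong wkT (trans (glue-vs a f g (inl a w)) (glue-inl a (f ∘ vs) g w))))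
    λ { vz     → cong (subT (lift W)) (glue-inr a ρf ρg vz)
      ; (vs u) → trans (cong (subT (lift W)) (glue-inr a ρf ρg (vs u)))
                       (cong wkT (trans (glue-vs a f g (inr a u)) (glue-inr a (f ∘ vs) g u))) }
    where
    W = glue ((σ *) ∷ a) f g
    ρf : Sub a (σ ∷ (σ *) ∷ a ++ Γ)
    ρf = var ∘ vs ∘ vs ∘ inl a
    ρg : Sub (σ ∷ Γ) (σ ∷ (σ *) ∷ a ++ Γ)
    ρg = var vz ▸ (var ∘ vs ∘ vs ∘ inr a)

  reinstate : ∀ {Γ σ} (a : Ctx) →
              (var (inr a vz) ▸ var) ⊙ glue a (wkT ∘ var ∘ inl a) (var vz ▸ (wkT ∘ var ∘ inr a ∘ vs))
                ≗ₛ var {a ++ σ ∷ Γ}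
  reinstate {Γ} {σ} a v = trans (glue-post a f g r v)
    (sym (glue-unique a {s = var} (subT r ∘ f) (subT r ∘ g) (λ _ → refl) (λ { vz → refl ; (vs u) → refl }) v))
    where
    r : Sub (σ ∷ a ++ σ ∷ Γ) (a ++ σ ∷ Γ)
    r = var (inr a vz) ▸ var
    f : Sub a (σ ∷ a ++ σ ∷ Γ)
    f = wkT ∘ var ∘ inl a
    g : Sub (σ ∷ Γ) (σ ∷ a ++ σ ∷ Γ)
    g = var vz ▸ (wkT ∘ var ∘ inr a ∘ vs)

  apply-at-vars : ∀ {Γ} (σ : Ty) (a : Ctx) → Sub a (σ ∷ map (σ ⇒_) a ++ Γ)
  apply-at-vars σ a x = app (var (vs (inl (map (σ ⇒_) a) (mapVar (σ ⇒_) x)))) (var vz)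

  apply-at-rest : ∀ {Γ} (σ : Ty) (a : Ctx) → Sub (σ ∷ Γ) (σ ∷ map (σ ⇒_) a ++ Γ)
  apply-at-rest σ a = var vz ▸ (var ∘ vs ∘ inr (map (σ ⇒_) a))

  apply-at : ∀ {Γ} (σ : Ty) (a : Ctx) → Sub (a ++ σ ∷ Γ) (σ ∷ map (σ ⇒_) a ++ Γ)
  apply-at σ a = glue a (apply-at-vars σ a) (apply-at-rest σ a)

  lift-glue-⊙-apply-at : ∀ {Γ Θ} (σ : Ty) (a : Ctx) (f : Sub (map (σ ⇒_) a) Θ) (g : Sub Γ Θ) →
                         lift (glue (map (σ ⇒_) a) f g) ⊙ apply-at σ a
                           ≗ₛ glue a (λ x → app (wkT (f (mapVar (σ ⇒_) x))) (var vz)) (var vz ▸ (wkT ∘ g))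
  lift-glue-⊙-apply-at σ a f g =
    glue-unique a {s = lift W ⊙ apply-at σ a} (λ x → app (wkT (f (mapVar (σ ⇒_) x))) (var vz)) (var vz ▸ (wkT ∘ g))
    (λ w → trans (cong (subT (lift W)) (glue-inl a (apply-at-vars σ a) (apply-at-rest σ a) w))
                 (cong (λ z → app (wkT z) (var vz)) (glue-inl (map (σ ⇒_) a) f g (mapVar (σ ⇒_) w))))
    λ { vz     → cong (subT (lift W)) (glue-inr a (apply-at-vars σ a) (apply-at-rest σ a) vz)
      ; (vs u) → trans (cong (subT (lift W)) (glue-inr a (apply-at-vars σ a) (apply-at-rest σ a) (vs u)))
                       (cong wkT (glue-inr (map (σ ⇒_) a) f g u)) }
    where W = glue (map (σ ⇒_) a) f g

  apply-at-∷ : ∀ {Γ} (ρ x : Ty) (xs : Ctx) →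
               apply-at ρ (x ∷ []) ⊙ lift (apply-at {Γ} ρ xs) ≗ₛ apply-at ρ (x ∷ xs)
  apply-at-∷ ρ x xs vz     = refl
  apply-at-∷ ρ x xs (vs v) =
    trans (subT-fuse {s = apply-at ρ (x ∷ [])} (λ _ → refl) (apply-at ρ xs v))
      (trans (glue-post xs (apply-at-vars ρ xs) (apply-at-rest ρ xs) (apply-at-rest ρ (x ∷ [])) v)
        (trans (glue-cong xs {f′ = apply-at-vars ρ (x ∷ xs) ∘ vs}
                              {g = subT (apply-at-rest ρ (x ∷ [])) ∘ apply-at-rest ρ xs}
                              {g′ = apply-at-rest ρ (x ∷ xs)}
                          (λ _ → refl) (λ { vz → refl ; (vs w) → refl }) v)
          (sym (glue-vs xs (apply-at-vars ρ (x ∷ xs)) (apply-at-rest ρ (x ∷ xs)) v))))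

  premise-sub : ∀ {Γ} (a b : Ctx) → Sub (a ++ Γ) (a ++ map (arrows a) b ++ Γ)
  premise-sub a b = liftN a (var ∘ inr (map (arrows a) b))

  -- (A → B)^HR ≡ ∃U̲ ∀x̲ (A_HR(x̲) → B_HR(U̲ x̲)); skolem-terms a b are the terms U_i x̲.
  skolem-terms : ∀ {Γ} (a b : Ctx) → Sub b (a ++ map (arrows a) b ++ Γ)
  skolem-terms a b i = appVars a (var (inr a (inl (map (arrows a) b) (mapVar (arrows a) i)))) (var ∘ inl a)

  conclusion-sub : ∀ {Γ} (a b : Ctx) → Sub (b ++ Γ) (a ++ map (arrows a) b ++ Γ)
  conclusion-sub a b = glue b (skolem-terms a b) (var ∘ inr a ∘ inr (map (arrows a) b))

  skolem-sub : ∀ {Γ} (a b : Ctx) → Sub (b ++ a ++ Γ) (a ++ map (arrows a) b ++ Γ)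
  skolem-sub a b = glue b (skolem-terms a b) (premise-sub a b)

  liftN-glue-⊙-premise : ∀ {Γ Θ} (a b : Ctx) (f : Sub (map (arrows a) b) Θ) (g : Sub Γ Θ) →
                         liftN a (glue (map (arrows a) b) f g) ⊙ premise-sub a b ≗ₛ liftN a g
  liftN-glue-⊙-premise a b f g = glue-unique a {s = liftN a W ⊙ premise-sub a b} (var ∘ inl a) (wkNT a ∘ g)
    (λ w → trans (cong (subT (liftN a W)) (liftN-inl a (var ∘ inr Us) w)) (liftN-inl a W w))
    (λ u → trans (cong (subT (liftN a W)) (liftN-inr a (var ∘ inr Us) u))
                 (trans (liftN-inr a W (inr Us u)) (cong (wkNT a) (glue-inr Us f g u))))
    where
    Us = map (arrows a) b
    W = glue Us f g

  liftN-glue-skolem-terms : ∀ {Γ Θ τ} (a b : Ctx) (f : Sub (map (arrows a) b) Θ) (g : Sub Γ Θ) (i : Var b τ) →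
                            subT (liftN a (glue (map (arrows a) b) f g)) (skolem-terms a b i)
                              ≡ appVars a (wkNT a (f (mapVar (arrows a) i))) (var ∘ inl a)
  liftN-glue-skolem-terms a b f g i =
    trans (appVars-sub a (liftN a W) _ (var ∘ inl a))
          (appVars-cong a (trans (liftN-inr a W (inl Us (mapVar (arrows a) i))) (cong (wkNT a) (glue-inl Us f g _)))
                          (liftN-inl a W))
    where
    Us = map (arrows a) b
    W = glue Us f g

  liftN-glue-⊙-conclusion : ∀ {Γ Θ} (a b : Ctx) (f : Sub (map (arrows a) b) Θ) (g : Sub Γ Θ) →
                            liftN a (glue (map (arrows a) b) f g) ⊙ conclusion-sub a b
                              ≗ₛ glue b (λ j → appVars a (wkNT a (f (mapVar (arrows a) j))) (var ∘ inl a)) (wkNT a ∘ g)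
  liftN-glue-⊙-conclusion a b f g = glue-unique b {s = liftN a W ⊙ conclusion-sub a b} _ (wkNT a ∘ g)
    (λ j → trans (cong (subT (liftN a W)) (glue-inl b (skolem-terms a b) (var ∘ inr a ∘ inr Us) j))
                 (liftN-glue-skolem-terms a b f g j))
    (λ u → trans (cong (subT (liftN a W)) (glue-inr b (skolem-terms a b) (var ∘ inr a ∘ inr Us) u))
                 (trans (liftN-inr a W (inr Us u)) (cong (wkNT a) (glue-inr Us f g u))))
    where
    Us = map (arrows a) b
    W = glue Us f g

  -- Monotonicity of hr in its witnesses

  infix 4 _⊢_≤ₛ_
  _⊢_≤ₛ_ : ∀ {Γ xs} → List (Fm Γ) → Sub xs Γ → Sub xs Γ → Set
  Δ ⊢ f₁ ≤ₛ f₂ = ∀ {τ} (i : Var _ τ) → Δ ⊢ Le τ (f₁ i) (f₂ i)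

  ≤ₛ-wk : ∀ {Γ σ xs} {Δ : List (Fm Γ)} {f₁ f₂ : Sub xs Γ} →
          Δ ⊢ f₁ ≤ₛ f₂ → map (wkF {σ = σ}) Δ ⊢ wkT ∘ f₁ ≤ₛ wkT ∘ f₂
  ≤ₛ-wk {f₁ = f₁} {f₂} le {τ} i = Le-wk {τ = τ} {f₁ i} {f₂ i} (le i)

  Monotone : (xs : Ctx) {Γ : Ctx} → Fm (xs ++ Γ) → Set
  Monotone xs {Γ} P = ∀ {Θ} {Δ : List (Fm Θ)} (f₁ f₂ : Sub xs Θ) (g : Sub Γ Θ) →
                      Δ ⊢ f₁ ≤ₛ f₂ → Δ ⊢ subF (glue xs f₁ g) P → Δ ⊢ subF (glue xs f₂ g) P

  Monotone-≗ : ∀ {ys Γ Θ} {Q : Fm (ys ++ Γ)} {Δ : List (Fm Θ)} → Monotone ys Q →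
               {s₁ s₂ : Sub (ys ++ Γ) Θ} (k₁ k₂ : Sub ys Θ) (h : Sub Γ Θ) →
               s₁ ≗ₛ glue ys k₁ h → s₂ ≗ₛ glue ys k₂ h → Δ ⊢ k₁ ≤ₛ k₂ → Δ ⊢ subF s₁ Q → Δ ⊢ subF s₂ Q
  Monotone-≗ {Q = Q} mQ k₁ k₂ h e₁ e₂ le d =
    cast (sym (subF-cong e₂ Q)) (mQ k₁ k₂ h le (cast (subF-cong e₁ Q) d))

  Monotone-along : ∀ {ys Γ Θ₁ Θ₂ Θ} {Q : Fm (ys ++ Γ)} {Δ : List (Fm Θ)} → Monotone ys Q →
                   {ρ₁ : Sub (ys ++ Γ) Θ₁} {ρ₂ : Sub (ys ++ Γ) Θ₂} {s₁ : Sub Θ₁ Θ} {s₂ : Sub Θ₂ Θ}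
                   (k₁ k₂ : Sub ys Θ) (h : Sub Γ Θ) →
                   s₁ ⊙ ρ₁ ≗ₛ glue ys k₁ h → s₂ ⊙ ρ₂ ≗ₛ glue ys k₂ h → Δ ⊢ k₁ ≤ₛ k₂ →
                   Δ ⊢ subF s₁ (subF ρ₁ Q) → Δ ⊢ subF s₂ (subF ρ₂ Q)
  Monotone-along {Q = Q} mQ k₁ k₂ h e₁ e₂ le d =
    cast (sym (subF-comp _ _ Q)) (Monotone-≗ mQ k₁ k₂ h e₁ e₂ le (cast (subF-comp _ _ Q) d))

  Monotone-Or : ∀ {Γ} (a b : Ctx) {P : Fm (a ++ Γ)} {Q : Fm (b ++ Γ)} → Monotone a P → Monotone b Q →
                Monotone (a ++ b) (Or (subF (pairˡ a b) P) (subF (pairʳ a b) Q))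
  Monotone-Or a b mP mQ f₁ f₂ g le d = orE d
    (orI₁ (Monotone-along mP (f₁ ∘ inl a) (f₂ ∘ inl a) g
            (glue-⊙-rename (a ++ b) a (inl a) f₁ g) (glue-⊙-rename (a ++ b) a (inl a) f₂ g)
            (weaken ∘ le ∘ inl a) (hyp (here refl))))
    (orI₂ (Monotone-along mQ (f₁ ∘ inr a) (f₂ ∘ inr a) g
            (glue-⊙-rename (a ++ b) b (inr a) f₁ g) (glue-⊙-rename (a ++ b) b (inr a) f₂ g)
            (weaken ∘ le ∘ inr a) (hyp (here refl))))

  Monotone-And : ∀ {Γ} (a b : Ctx) {P : Fm (a ++ Γ)} {Q : Fm (b ++ Γ)} → Monotone a P → Monotone b Q →
                 Monotone (a ++ b) (And (subF (pairˡ a b) P) (subF (pairʳ a b) Q))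
  Monotone-And a b mP mQ f₁ f₂ g le d = andI
    (Monotone-along mP (f₁ ∘ inl a) (f₂ ∘ inl a) g
      (glue-⊙-rename (a ++ b) a (inl a) f₁ g) (glue-⊙-rename (a ++ b) a (inl a) f₂ g) (le ∘ inl a) (andE₁ d))
    (Monotone-along mQ (f₁ ∘ inr a) (f₂ ∘ inr a) g
      (glue-⊙-rename (a ++ b) b (inr a) f₁ g) (glue-⊙-rename (a ++ b) b (inr a) f₂ g) (le ∘ inr a) (andE₂ d))

  Monotone-Imp : ∀ {Γ} (a b : Ctx) (P : Fm (a ++ Γ)) {Q : Fm (b ++ Γ)} → Monotone b Q →
                 Monotone (map (arrows a) b) (allN a (Imp (subF (premise-sub a b) P) (subF (conclusion-sub a b) Q)))
  Monotone-Imp {Γ} a b P {Q} mQ {Θ} {Δ} f₁ f₂ g le d =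
    cast (sym (allN-sub a (glue Us f₂ g) M))
      (allNI a (impI (Monotone-along mQ (applied f₁) (applied f₂) (wkNT a ∘ g)
                        (liftN-glue-⊙-conclusion a b f₁ g) (liftN-glue-⊙-conclusion a b f₂ g) (weaken ∘ applied-≤)
        (impE (weaken (allNE-vars a (cast (allN-sub a (glue Us f₁ g) M) d)))
              (cast premise-irrelevant (hyp (here refl)))))))
    where
    Us = map (arrows a) b
    M : Fm (a ++ Us ++ Γ)
    M = Imp (subF (premise-sub a b) P) (subF (conclusion-sub a b) Q)
    applied : Sub Us Θ → Sub b (a ++ Θ)
    applied f j = appVars a (wkNT a (f (mapVar (arrows a) j))) (var ∘ inl a)
    applied-≤ : map (wkN a) Δ ⊢ applied f₁ ≤ₛ applied f₂
    applied-≤ j = Le-appVars a (⊢-Le-sub (var ∘ inr a) (∈-map⁺ (wkN a)) (le (mapVar (arrows a) j))) (var ∘ inl a)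
    premise-irrelevant : subF (liftN a (glue Us f₂ g)) (subF (premise-sub a b) P)
                       ≡ subF (liftN a (glue Us f₁ g)) (subF (premise-sub a b) P)
    premise-irrelevant = trans (subF-fuse (liftN-glue-⊙-premise a b f₂ g) P)
                               (sym (subF-fuse (liftN-glue-⊙-premise a b f₁ g) P))

  Monotone-All : ∀ {Γ} (σ : Ty) (a : Ctx) {P : Fm (a ++ σ ∷ Γ)} → Monotone a P →
                 Monotone (map (σ ⇒_) a) (All σ (subF (apply-at σ a) P))
  Monotone-All σ a mP f₁ f₂ g le d =
    allI (Monotone-along mP (at-vz f₁) (at-vz f₂) (var vz ▸ (wkT ∘ g))
            (lift-glue-⊙-apply-at σ a f₁ g) (lift-glue-⊙-apply-at σ a f₂ g)
            (λ i → Le-app (≤ₛ-wk le (mapVar (σ ⇒_) i)) (var vz)) (allE-fresh d))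
    where
    at-vz : Sub (map (σ ⇒_) a) _ → Sub a _
    at-vz f x = app (wkT (f (mapVar (σ ⇒_) x))) (var vz)

  Monotone-Ex : ∀ {Γ} (σ : Ty) (a : Ctx) {P : Fm (a ++ σ ∷ Γ)} → Monotone a P →
                Monotone ((σ *) ∷ a) (BEx (var vz) (subF (witness-sub a) P))
  Monotone-Ex σ a mP f₁ f₂ g le d =
    bexE d (bexI (var vz) (Le-mem (weaken (weaken (≤ₛ-wk le vz))) (hyp (there (here refl))))
      (cast (sym (inst-vz-lift-wk _))
        (Monotone-along mP (wkT ∘ f₁ ∘ vs) (wkT ∘ f₂ ∘ vs) (var vz ▸ (wkT ∘ g))
          (lift-glue-⊙-witness σ a f₁ g) (lift-glue-⊙-witness σ a f₂ g)
          (weaken ∘ weaken ∘ ≤ₛ-wk le ∘ vs) (hyp (here refl)))))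

  Monotone-BAll : ∀ {Γ σ} (a : Ctx) (t : Tm Γ (σ *)) {P : Fm (a ++ σ ∷ Γ)} → Monotone a P →
                  Monotone a (BAll (wkNT a t) (subF (bound-sub a) P))
  Monotone-BAll a t mP f₁ f₂ g le d =
    cast (cong₂ BAll (sym (wkNT-glue a f₂ g t)) refl)
      (ballI (Monotone-along mP (wkT ∘ f₁) (wkT ∘ f₂) (var vz ▸ (wkT ∘ g))
                (lift-glue-⊙-bound a f₁ g) (lift-glue-⊙-bound a f₂ g) (weaken ∘ ≤ₛ-wk le)
                (ballE-fresh (cast (cong₂ BAll (wkNT-glue a f₁ g t) refl) d))))

  Monotone-BEx : ∀ {Γ σ} (a : Ctx) (t : Tm Γ (σ *)) {P : Fm (a ++ σ ∷ Γ)} → Monotone a P →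
                 Monotone a (BEx (wkNT a t) (subF (bound-sub a) P))
  Monotone-BEx a t mP f₁ f₂ g le d =
    cast (cong₂ BEx (sym (wkNT-glue a f₂ g t)) refl)
      (bexE (cast (cong₂ BEx (wkNT-glue a f₁ g t) refl) d)
        (bexI (var vz) (hyp (there (here refl)))
          (cast (sym (inst-vz-lift-wk _))
            (Monotone-along mP (wkT ∘ f₁) (wkT ∘ f₂) (var vz ▸ (wkT ∘ g))
              (lift-glue-⊙-bound a f₁ g) (lift-glue-⊙-bound a f₂ g) (weaken ∘ weaken ∘ ≤ₛ-wk le)
              (hyp (here refl))))))

  hr-monotone : ∀ {Γ} (A : Fm Γ) → Monotone (wt A) (hr A)
  hr-monotone Bot        f₁ f₂ g le d = d
  hr-monotone (Eq t q)   f₁ f₂ g le d = d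
  hr-monotone (Mem t q)  f₁ f₂ g le d = d
  hr-monotone (R r ts)   f₁ f₂ g le d = d
  hr-monotone (Or A B)   = Monotone-Or (wt A) (wt B) (hr-monotone A) (hr-monotone B)
  hr-monotone (And A B)  = Monotone-And (wt A) (wt B) (hr-monotone A) (hr-monotone B)
  hr-monotone (Imp A B)  = Monotone-Imp (wt A) (wt B) (hr A) (hr-monotone B)
  hr-monotone (All σ A)  = Monotone-All σ (wt A) (hr-monotone A)
  hr-monotone (Ex σ A)   = Monotone-Ex σ (wt A) (hr-monotone A)
  hr-monotone (BAll t A) = Monotone-BAll (wt A) t (hr-monotone A)
  hr-monotone (BEx t A)  = Monotone-BEx (wt A) t (hr-monotone A)

  Monotone-⇒wk : ∀ {Γ} (xs : Ctx) (P : Fm Γ) {Q : Fm (xs ++ Γ)} → Monotone xs Q → Monotone xs (Imp (wkN xs P) Q)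
  Monotone-⇒wk xs P mQ f₁ f₂ g le d =
    impI (mQ f₁ f₂ g (weaken ∘ le)
      (impE (weaken d) (cast (trans (wkN-glue xs f₂ g P) (sym (wkN-glue xs f₁ g P))) (hyp (here refl)))))

  Monotone-liftN : ∀ {Γ Δ} (xs : Ctx) (s : Sub Γ Δ) {Q : Fm (xs ++ Γ)} →
                   Monotone xs Q → Monotone xs (subF (liftN xs s) Q)
  Monotone-liftN xs s mQ f₁ f₂ g le =
    Monotone-along mQ f₁ f₂ (g ⊙ s) (glue-⊙-liftN xs f₁ g s) (glue-⊙-liftN xs f₂ g s) le

  Monotone-lift : ∀ {Γ Δ x} {t : Sub (x ∷ Γ) (x ∷ Δ)} (s : Sub Γ Δ) {Q : Fm (x ∷ Γ)} →
                  t ≗ₛ lift s → Monotone (x ∷ []) Q → Monotone (x ∷ []) (subF t Q)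
  Monotone-lift {x = x} s {Q} e mQ =
    subst (Monotone (x ∷ [])) (subF-cong (λ v → trans (liftN-single v) (sym (e v))) Q) (Monotone-liftN (x ∷ []) s mQ)
    where
    liftN-single : liftN (x ∷ []) s ≗ₛ lift s
    liftN-single vz     = refl
    liftN-single (vs v) = refl

  Monotone-∃-head : ∀ {Γ x} (xs : Ctx) {P : Fm (x ∷ xs ++ Γ)} → Monotone (x ∷ xs) P → Monotone xs (Ex x P)
  Monotone-∃-head {Γ} {x} xs {P} mP {Θ} {Δ} f₁ f₂ g le =
    ex-map (Monotone-≗ mP (var vz ▸ (wkT ∘ f₁)) (var vz ▸ (wkT ∘ f₂)) (wkT ∘ g)
              (lift-glue f₁) (lift-glue f₂) extend-≤ (hyp (here refl)))
    where
    lift-glue : (f : Sub xs Θ) → lift (glue xs f g) ≗ₛ glue (x ∷ xs) (var vz ▸ (wkT ∘ f)) (wkT ∘ g)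
    lift-glue f vz     = refl
    lift-glue f (vs v) = trans (glue-post xs f g (var ∘ vs) v) (sym (glue-vs xs (var vz ▸ (wkT ∘ f)) (wkT ∘ g) v))
    extend-≤ : (subF (lift (glue xs f₁ g)) P ∷ map wkF Δ) ⊢ var vz ▸ (wkT ∘ f₁) ≤ₛ var vz ▸ (wkT ∘ f₂)
    extend-≤ {τ} vz = Le-refl τ (var vz)
    extend-≤ (vs i) = weaken (≤ₛ-wk le i)

  Monotone-head : ∀ {Γ x} (xs : Ctx) {P : Fm (x ∷ xs ++ Γ)} → Monotone (x ∷ xs) P → Monotone (x ∷ []) {xs ++ Γ} P
  Monotone-head {Γ} {x} xs {P} mP {Θ} {Δ} f₁ f₂ g le =
    Monotone-≗ mP (extend f₁) (extend f₂) (g ∘ inr xs) (regroup f₁) (regroup f₂) extend-≤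
    where
    extend : Sub (x ∷ []) Θ → Sub (x ∷ xs) Θ
    extend f vz     = f vz
    extend f (vs w) = g (inl xs w)
    regroup : (f : Sub (x ∷ []) Θ) → glue (x ∷ []) f g ≗ₛ glue (x ∷ xs) (extend f) (g ∘ inr xs)
    regroup f vz     = refl
    regroup f (vs v) = trans (glue-unique xs {s = g} (extend f ∘ vs) (g ∘ inr xs) (λ _ → refl) (λ _ → refl) v)
                             (sym (glue-vs xs (extend f) (g ∘ inr xs) v))
    extend-≤ : Δ ⊢ extend f₁ ≤ₛ extend f₂
    extend-≤ vz         = le vz
    extend-≤ {τ} (vs w) = Le-refl τ _

  -- Choice and independence of premise for monotone formulas

  single : ∀ {Γ x} → Tm Γ x → Sub (x ∷ []) Γ
  single t vz = t

  BEx-≤ : ∀ {Γ x} {Δ : List (Fm Γ)} {S : Tm Γ (x *)} {A : Fm (x ∷ Γ)} (T : Tm Γ x) → Monotone (x ∷ []) A →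
          (Mem (var vz) (wkT S) ∷ map wkF Δ) ⊢ Le x (var vz) (wkT T) → Δ ⊢ BEx S A → Δ ⊢ A [ T ]
  BEx-≤ {A = A} T mA bound d = bexE d
    (cast (sym (subF-fuse (λ { vz → refl ; (vs v) → refl }) A))
      (mA (single (var vz)) (single (wkT T)) (var ∘ vs) (λ { vz → weaken bound })
        (cast (sym (subF-≗id (λ { vz → refl ; (vs v) → refl }) A)) (hyp (here refl)))))

  monotone-choice : ∀ {Γ ρ x} {Δ : List (Fm Γ)} (p : StarEnding x) {Q : Fm (x ∷ ρ ∷ Γ)} →
                    Monotone (x ∷ []) Q →
                    Δ ⊢ All ρ (Ex x Q) → Δ ⊢ Ex (ρ ⇒ x) (All ρ (subF (apply-at ρ (x ∷ [])) Q))
  monotone-choice {Γ} {ρ} {x} {Δ} p {Q} mQ d =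
    exE (impE (ax (ac Q)) d)
      (exI X (cast (sym X-inst) (allI
        (cast (subF-fuse (λ { vz → refl ; (vs vz) → refl ; (vs (vs w)) → refl }) Q)
          (BEx-≤ {S = app (var (vs vz)) (var vz)} (app (wkT X) (var vz))
                 (Monotone-lift (var vz ▸ (var ∘ vs ∘ vs)) (λ { vz → refl ; (vs vz) → refl ; (vs (vs w)) → refl }) mQ)
                 (Le-Eq x (Le-sup p (hyp (here refl))) X-β)
                 (allE-vz (hyp (here refl))))))))
    where
    F = ρ ⇒ x *
    body : Tm (ρ ∷ F ∷ Γ) x
    body = supT p (app (var (vs vz)) (var vz))
    X : Tm (F ∷ Γ) (ρ ⇒ x)
    X = abs body
    X-inst : (subF (lift (var ∘ vs)) (All ρ (subF (apply-at ρ (x ∷ [])) Q))) [ X ]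
           ≡ All ρ (subF (app (wkT X) (var vz) ▸ (var vz ▸ (var ∘ vs ∘ vs))) Q)
    X-inst = cong (All ρ) (trans (subF-comp _ _ _) (subF-fuse (λ { vz → refl ; (vs vz) → refl ; (vs (vs w)) → refl }) Q))
    X-β : ∀ {Θ} → Θ ⊢ Eq (supT p (app (var (vs (vs vz))) (var (vs vz)))) (wkT (app (wkT X) (var vz)))
    X-β = cast (cong₂ Eq (cong (λ z → app z (app (var (vs (vs vz))) (var (vs vz)))) (subT-closed _ (sup p)))
                         (cong (λ z → app z (var (vs vz))) (sym (subT-comp (var ∘ vs) (var ∘ vs) X))))
               (Eq-sym (abs-β ((var ∘ vs) ⊙ (var ∘ vs)) body (var (vs vz))))

  monotone-ip : ∀ {Γ x} {Δ : List (Fm Γ)} (p : StarEnding x) (B : Fm Γ) → ExFree B → {A : Fm (x ∷ Γ)} →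
                Monotone (x ∷ []) A → Δ ⊢ Imp B (Ex x A) → Δ ⊢ Ex x (Imp (wkF B) A)
  monotone-ip {Γ} {x} p B ef {A} mA d =
    exE (impE (ax (ip B ef A)) d)
      (exI U (cast (sym U-inst) (impI
        (cast (subF-fuse (λ { vz → refl ; (vs w) → refl }) A)
          (BEx-≤ U (Monotone-lift (var ∘ vs) (λ { vz → refl ; (vs w) → refl }) mA)
                 (cast (cong (Le x (var vz)) (sym (supT-wk p (var vz)))) (Le-sup p (hyp (here refl))))
                 (impE (hyp (there (here refl))) (hyp (here refl))))))))
    where
    U : Tm ((x *) ∷ Γ) x
    U = supT p (var vz)
    U-inst : (subF (lift (var ∘ vs)) (Imp (wkF B) A)) [ U ] ≡ Imp (wkF B) (subF (U ▸ (var ∘ vs)) A)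
    U-inst = cong₂ Imp (trans (subF-comp _ _ (wkF B)) (subF-fuse (λ v → refl) B))
                       (subF-fuse (λ { vz → refl ; (vs w) → refl }) A)

  monotone-choiceN : ∀ {Γ ρ} (xs : Ctx) → ListAll.All StarEnding xs → {Δ : List (Fm Γ)} {P : Fm (xs ++ ρ ∷ Γ)} →
                     Monotone xs P → Δ ⊢ All ρ (exN xs P) → Δ ⊢ exN (map (ρ ⇒_) xs) (All ρ (subF (apply-at ρ xs) P))
  monotone-choiceN [] ListAll.[] {P = P} mP d =
    cast (cong (All _) (sym (subF-≗id (λ { vz → refl ; (vs w) → refl }) P))) d
  monotone-choiceN {ρ = ρ} (x ∷ xs) (p ListAll.∷ ps) {P = P} mP d =
    exN-map (map (ρ ⇒_) xs)
      (cast (cong (Ex (ρ ⇒ x) ∘ All ρ) (subF-fuse (apply-at-∷ ρ x xs) P))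
        (monotone-choice p (Monotone-lift (apply-at ρ xs) (λ _ → refl) (Monotone-head xs mP)) (hyp (here refl))))
      (monotone-choiceN xs ps (Monotone-∃-head xs mP) d)

  monotone-ipN : ∀ {Γ} (xs : Ctx) → ListAll.All StarEnding xs → {Δ : List (Fm Γ)} (B : Fm Γ) → ExFree B →
                 {A : Fm (xs ++ Γ)} → Monotone xs A → Δ ⊢ Imp B (exN xs A) → Δ ⊢ exN xs (Imp (wkN xs B) A)
  monotone-ipN [] ListAll.[] B ef {A} mA d = cast (cong (λ z → Imp z A) (sym (wkN-[] B))) d
  monotone-ipN (x ∷ xs) (p ListAll.∷ ps) B ef {A} mA d =
    exN-map xs (cast (cong (λ z → Ex x (Imp z A)) (wkN-∷ x xs B))
                  (monotone-ip p (wkN xs B) (exFree-sub _ B ef) (Monotone-head xs mA) (hyp (here refl))))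
      (monotone-ipN xs ps B ef (Monotone-∃-head xs mA) d)

  -- rot W = λx y̲. W y̲ x
  rot : ∀ {Γ x τ} (a : Ctx) → Tm Γ (arrows a (x ⇒ τ)) → Tm Γ (x ⇒ arrows a τ)
  rot []      W = W
  rot (y ∷ a) W = abs (abs (app (rot a (app (wkT (wkT W)) (var vz))) (var (vs vz))))

  appVars-Eq : ∀ {Γ τ} {Δ : List (Fm Γ)} (xs : Ctx) {t t′ : Tm Γ (arrows xs τ)} (h : Sub xs Γ) →
               Δ ⊢ Eq t t′ → Δ ⊢ Eq (appVars xs t h) (appVars xs t′ h)
  appVars-Eq []       h e = e
  appVars-Eq (x ∷ xs) h e = appVars-Eq xs (h ∘ vs) (Eq-appˡ (h vz) e)

  rot-β : ∀ {Γ Θ x τ} {Δ : List (Fm Θ)} (a : Ctx) (s : Sub Γ Θ) (W : Tm Γ (arrows a (x ⇒ τ))) (h : Sub (x ∷ a) Θ) →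
          Δ ⊢ Eq (appVars (x ∷ a) (subT s (rot a W)) h) (app (appVars a (subT s W) (h ∘ vs)) (h vz))
  rot-β []      s W h = Eq-refl _
  rot-β {Δ = Δ} (y ∷ a) s W h =
    Eq-trans (appVars-Eq a (h ∘ vs ∘ vs) (Eq-trans (Eq-appˡ (h (vs vz)) (abs-β s (abs body) (h vz)))
                                                   (abs-β (h vz ▸ s) body (h (vs vz)))))
      (subst (λ z → Δ ⊢ Eq (appVars a (subT θ body) (h ∘ vs ∘ vs))
                           (app (appVars a (app z (h (vs vz))) (h ∘ vs ∘ vs)) (h vz)))
             (trans (subT-fuse (λ _ → refl) (wkT W)) (subT-fuse (λ _ → refl) W))
             (rot-β a θ (app (wkT (wkT W)) (var vz)) (h vz ▸ (h ∘ vs ∘ vs))))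
    where
    body = app (rot a (app (wkT (wkT W)) (var vz))) (var (vs vz))
    θ = h (vs vz) ▸ (h vz ▸ s)

  rotate : ∀ {Θ x} (a b : Ctx) → Sub (map (arrows a) (map (x ⇒_) b)) Θ → Sub (map (arrows (x ∷ a)) b) Θ
  rotate a (y ∷ b) W vz     = rot a (W vz)
  rotate a (y ∷ b) W (vs j) = rotate a b (W ∘ vs) j

  rotate-mapVar : ∀ {Θ x τ} (a b : Ctx) (W : Sub (map (arrows a) (map (x ⇒_) b)) Θ) (i : Var b τ) →
                  rotate a b W (mapVar (arrows (x ∷ a)) i) ≡ rot a (W (mapVar (arrows a) (mapVar (x ⇒_) i)))
  rotate-mapVar a (y ∷ b) W vz     = refl
  rotate-mapVar a (y ∷ b) W (vs i) = rotate-mapVar a b (W ∘ vs) i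

  -- map (arrows []) b is b only up to propositional equality.
  unarrow : ∀ {Θ} (b : Ctx) → Sub b Θ → Sub (map (arrows []) b) Θ
  unarrow (y ∷ b) f vz     = f vz
  unarrow (y ∷ b) f (vs j) = unarrow b (f ∘ vs) j

  unarrow-mapVar : ∀ {Θ τ} (b : Ctx) (f : Sub b Θ) (i : Var b τ) → unarrow b f (mapVar (arrows []) i) ≡ f i
  unarrow-mapVar (y ∷ b) f vz     = refl
  unarrow-mapVar (y ∷ b) f (vs i) = unarrow-mapVar b (f ∘ vs) i

  skolem-rotate : ∀ {Γ} (x : Ty) (a b : Ctx) {Δ : List (Fm Γ)} {Q : Fm (b ++ x ∷ a ++ Γ)} → Monotone b Q →
                  Δ ⊢ exN (map (arrows a) (map (x ⇒_) b))
                          (allN a (subF (skolem-sub a (map (x ⇒_) b)) (All x (subF (apply-at x b) Q)))) →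
                  Δ ⊢ exN (map (arrows (x ∷ a)) b) (allN (x ∷ a) (subF (skolem-sub (x ∷ a) b) Q))
  skolem-rotate {Γ} x a b {Δ} {Q} mQ d =
    exNE Ws d (exNI-sub Zs f (var ∘ inr Ws) (cast (sym (allN-sub A Φ _)) (allNI A
      (Monotone-along mQ k₁ k₂ (liftN A (var ∘ inr Ws)) before after (λ i → Le-Eq _ (Le-refl _ (k₁ i)) (k₁≐k₂ i))
        (allNE-vars A (hyp (here refl)))))))
    where
    A = x ∷ a
    b′ = map (x ⇒_) b
    Ws = map (arrows a) b′
    Zs = map (arrows A) b
    f : Sub Zs (Ws ++ Γ)
    f = rotate a b (var ∘ inl Ws)
    Φ : Sub (Zs ++ Γ) (Ws ++ Γ)
    Φ = glue Zs f (var ∘ inr Ws)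
    k₁ k₂ : Sub b (A ++ Ws ++ Γ)
    k₁ i = app (wkT (skolem-terms a b′ (mapVar (x ⇒_) i))) (var vz)
    k₂ i = appVars A (wkNT A (f (mapVar (arrows A) i))) (var ∘ inl A)
    -- k₁ and k₂ agree only up to β, so the transport from k₁ to k₂ goes through monotonicity.
    k₁≐k₂ : ∀ {Θ τ} (i : Var b τ) → Θ ⊢ Eq (k₁ i) (k₂ i)
    k₁≐k₂ i = Eq-sym (cast (cong₂ Eq
        (cong (λ z → appVars A (wkNT A z) (var ∘ inl A)) (sym (rotate-mapVar a b (var ∘ inl Ws) i)))
        (cong (λ z → app z (var vz)) (sym (appVars-sub a (var ∘ vs) _ (var ∘ inl a)))))
      (rot-β a (var ∘ inr A) (var (inl Ws (mapVar (arrows a) (mapVar (x ⇒_) i)))) (var ∘ inl A)))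
    before : lift (skolem-sub a b′) ⊙ apply-at x b ≗ₛ glue b k₁ (liftN A (var ∘ inr Ws))
    before v = trans (lift-glue-⊙-apply-at x b (skolem-terms a b′) (premise-sub a b′) v)
                     (glue-cong b {f = k₁} (λ _ → refl) (lift-liftN x a (var ∘ inr Ws)) v)
    after : liftN A Φ ⊙ skolem-sub A b ≗ₛ glue b k₂ (liftN A (var ∘ inr Ws))
    after = glue-unique b {s = liftN A Φ ⊙ skolem-sub A b} k₂ (liftN A (var ∘ inr Ws))
      (λ i → trans (cong (subT (liftN A Φ)) (glue-inl b (skolem-terms A b) (premise-sub A b) i))
                   (liftN-glue-skolem-terms A b f (var ∘ inr Ws) i))
      (λ u → trans (cong (subT (liftN A Φ)) (glue-inr b (skolem-terms A b) (premise-sub A b) u))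
                   (liftN-glue-⊙-premise A b f (var ∘ inr Ws) u))

  choice-allN : ∀ (a b : Ctx) → ListAll.All StarEnding b → ∀ {Γ} {Δ : List (Fm Γ)} {Q : Fm (b ++ a ++ Γ)} →
                Monotone b Q → Δ ⊢ allN a (exN b Q) → Δ ⊢ exN (map (arrows a) b) (allN a (subF (skolem-sub a b) Q))
  choice-allN [] b ps {Γ} {Δ} {Q} mQ d =
    exNE b d (exNI-sub Zs f (var ∘ inr b) (cast (sym (subF-fuse-id unskolem Q)) (hyp (here refl))))
    where
    Zs = map (arrows []) b
    f : Sub Zs (b ++ Γ)
    f = unarrow b (var ∘ inl b)
    unskolem : glue Zs f (var ∘ inr b) ⊙ skolem-sub [] b ≗ₛ var
    unskolem v = trans
      (glue-unique b {s = glue Zs f (var ∘ inr b) ⊙ skolem-sub [] b} (var ∘ inl b) (var ∘ inr b)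
        (λ i → trans (cong (subT (glue Zs f (var ∘ inr b))) (glue-inl b (skolem-terms [] b) (premise-sub [] b) i))
                     (trans (glue-inl Zs f (var ∘ inr b) (mapVar (arrows []) i)) (unarrow-mapVar b (var ∘ inl b) i)))
        (λ u → trans (cong (subT (glue Zs f (var ∘ inr b))) (glue-inr b (skolem-terms [] b) (premise-sub [] b) u))
                     (glue-inr Zs f (var ∘ inr b) u)) v)
      (glue-vars b v)
  choice-allN (x ∷ a) b ps mQ d =
    skolem-rotate x a b mQ
      (choice-allN a (map (x ⇒_) b) (ListAllP.map⁺ (ListAll.map (x ⇒_) ps)) (Monotone-All x b mQ)
        (allN-map a (monotone-choiceN b ps mQ (hyp (here refl))) d))

  -- Equivalence of A and A^HR

  iff-intro : ∀ {Γ} {A B : Fm Γ} → (A ∷ []) ⊢ B → (B ∷ []) ⊢ A → [] ⊢ Iff A B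
  iff-intro d e = andI (impI d) (impI e)

  iff-refl : ∀ {Γ} (A : Fm Γ) → [] ⊢ Iff A A
  iff-refl A = iff-intro (hyp (here refl)) (hyp (here refl))

  iff-⇒ : ∀ {Γ Θ} {Δ : List (Fm Θ)} {A B : Fm Γ} → [] ⊢ Iff A B → (s : Sub Γ Θ) → Δ ⊢ subF s A → Δ ⊢ subF s B
  iff-⇒ eq s = impE (⊢-closed (⊢-sub s (λ ()) (andE₁ eq)))

  to-HR : ∀ {Γ} {Δ : List (Fm Γ)} {A : Fm Γ} → [] ⊢ Iff A (HR A) → Δ ⊢ A → Δ ⊢ HR A
  to-HR eq = impE (⊢-closed (andE₁ eq))

  from-hr : ∀ {Γ Θ} {Δ : List (Fm Θ)} {A : Fm Γ} → [] ⊢ Iff A (HR A) →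
            (s : Sub Γ Θ) (f : Sub (wt A) Θ) → Δ ⊢ subF (glue (wt A) f s) (hr A) → Δ ⊢ subF s A
  from-hr {A = A} eq s f d = impE (⊢-closed (⊢-sub s (λ ()) (andE₂ eq))) (exNI-sub (wt A) f s d)

  exFree-allN : ∀ {Γ} (xs : Ctx) {M : Fm (xs ++ Γ)} → ExFree M → ExFree (allN xs M)
  exFree-allN []       e = e
  exFree-allN (x ∷ xs) e = exFree-allN xs e

  exFree-hr : ∀ {Γ} (A : Fm Γ) → ExFree (hr A)
  exFree-hr Bot        = tt
  exFree-hr (Eq t q)   = tt
  exFree-hr (Mem t q)  = tt
  exFree-hr (R r ts)   = tt
  exFree-hr (Or A B)   = exFree-sub _ (hr A) (exFree-hr A) , exFree-sub _ (hr B) (exFree-hr B)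
  exFree-hr (And A B)  = exFree-sub _ (hr A) (exFree-hr A) , exFree-sub _ (hr B) (exFree-hr B)
  exFree-hr (Imp A B)  = exFree-allN (wt A) (exFree-sub _ (hr A) (exFree-hr A) , exFree-sub _ (hr B) (exFree-hr B))
  exFree-hr (All σ A)  = exFree-sub _ (hr A) (exFree-hr A)
  exFree-hr (Ex σ A)   = exFree-sub _ (hr A) (exFree-hr A)
  exFree-hr (BAll t A) = exFree-sub _ (hr A) (exFree-hr A)
  exFree-hr (BEx t A)  = exFree-sub _ (hr A) (exFree-hr A)

  HR-Or : ∀ {Γ} {A B : Fm Γ} → [] ⊢ Iff A (HR A) → [] ⊢ Iff B (HR B) → [] ⊢ Iff (Or A B) (HR (Or A B))
  HR-Or {Γ} {A} {B} eqA eqB = iff-intro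
    (orE (hyp (here refl))
      (exNE a (to-HR eqA (hyp (here refl)))
        (exNI-sub (a ++ b) pad-right (var ∘ inr a) (orI₁ (cast (sym (unpad a pairˡ-pad)) (hyp (here refl))))))
      (exNE b (to-HR eqB (hyp (here refl)))
        (exNI-sub (a ++ b) pad-left (var ∘ inr b) (orI₂ (cast (sym (unpad b pairʳ-pad)) (hyp (here refl)))))))
    (exNE (a ++ b) (hyp (here refl)) (orE (hyp (here refl))
      (orI₁ (from-hr eqA (var ∘ inr (a ++ b)) (var ∘ inl (a ++ b) ∘ inl a) (hyp (here refl))))
      (orI₂ (from-hr eqB (var ∘ inr (a ++ b)) (var ∘ inl (a ++ b) ∘ inr a) (hyp (here refl))))))
    where
    a = wt A
    b = wt B
    -- The witnesses for the disjunct that is not asserted are arbitrary.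
    pad-right : Sub (a ++ b) (a ++ Γ)
    pad-right = glue a (var ∘ inl a) inhabitants
    pad-left : Sub (a ++ b) (b ++ Γ)
    pad-left = glue a inhabitants (var ∘ inl b)
    unpad : ∀ {Θ} (xs : Ctx) {s : Sub Θ (xs ++ Γ)} {t : Sub (xs ++ Γ) Θ} {P} →
            s ⊙ t ≗ₛ glue xs (var ∘ inl xs) (var ∘ inr xs) → subF s (subF t P) ≡ P
    unpad xs {P = P} e = subF-fuse-id (λ v → trans (e v) (glue-vars xs v)) P
    pairˡ-pad : glue (a ++ b) pad-right (var ∘ inr a) ⊙ pairˡ a b ≗ₛ glue a (var ∘ inl a) (var ∘ inr a)
    pairˡ-pad v = trans (glue-⊙-rename (a ++ b) a (inl a) pad-right (var ∘ inr a) v)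
                        (glue-cong a {g = var ∘ inr a} (glue-inl a (var ∘ inl a) inhabitants) (λ _ → refl) v)
    pairʳ-pad : glue (a ++ b) pad-left (var ∘ inr b) ⊙ pairʳ a b ≗ₛ glue b (var ∘ inl b) (var ∘ inr b)
    pairʳ-pad v = trans (glue-⊙-rename (a ++ b) b (inr a) pad-left (var ∘ inr b) v)
                        (glue-cong b {g = var ∘ inr b} (glue-inr a inhabitants (var ∘ inl b)) (λ _ → refl) v)

  HR-And : ∀ {Γ} {A B : Fm Γ} → [] ⊢ Iff A (HR A) → [] ⊢ Iff B (HR B) → [] ⊢ Iff (And A B) (HR (And A B))
  HR-And {Γ} {A} {B} eqA eqB = iff-intro
    (exNE a (to-HR eqA (andE₁ (hyp (here refl))))
      (exNE b (cast (exN-sub b (var ∘ inr a) (hr B)) (iff-⇒ eqB (var ∘ inr a) (andE₂ (hyp (there (here refl))))))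
        (cast (sym (subF-fuse (λ _ → refl) (HR (And A B))))
          (exNI-sub (a ++ b) both (var ∘ inr b ∘ inr a)
            (andI (cast (sym (subF-fuse both-left (hr A))) (hyp (there (here refl))))
                  (cast (sym (subF-fuse both-right (hr B))) (hyp (here refl))))))))
    (exNE (a ++ b) (hyp (here refl)) (andI
      (from-hr eqA (var ∘ inr (a ++ b)) (var ∘ inl (a ++ b) ∘ inl a) (andE₁ (hyp (here refl))))
      (from-hr eqB (var ∘ inr (a ++ b)) (var ∘ inl (a ++ b) ∘ inr a) (andE₂ (hyp (here refl))))))
    where
    a = wt A
    b = wt B
    both : Sub (a ++ b) (b ++ a ++ Γ)
    both = glue a (var ∘ inr b ∘ inl a) (var ∘ inl b)
    both-left : glue (a ++ b) both (var ∘ inr b ∘ inr a) ⊙ pairˡ a b ≗ₛ var ∘ inr b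
    both-left v = trans (glue-⊙-rename (a ++ b) a (inl a) both (var ∘ inr b ∘ inr a) v)
      (sym (glue-unique a {s = var ∘ inr b} (both ∘ inl a) (var ∘ inr b ∘ inr a)
              (λ w → sym (glue-inl a (var ∘ inr b ∘ inl a) (var ∘ inl b) w)) (λ _ → refl) v))
    both-right : glue (a ++ b) both (var ∘ inr b ∘ inr a) ⊙ pairʳ a b ≗ₛ liftN b (var ∘ inr a)
    both-right v = trans (glue-⊙-rename (a ++ b) b (inr a) both (var ∘ inr b ∘ inr a) v)
                         (glue-cong b {g = var ∘ inr b ∘ inr a}
                                      (glue-inr a (var ∘ inr b ∘ inl a) (var ∘ inl b)) (λ _ → refl) v)

  HR-Imp : ∀ {Γ} {A B : Fm Γ} → [] ⊢ Iff A (HR A) → [] ⊢ Iff B (HR B) → [] ⊢ Iff (Imp A B) (HR (Imp A B))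
  HR-Imp {Γ} {A} {B} eqA eqB = iff-intro
    (cast (cong (exN Us ∘ allN a) (cong₂ Imp (wkN-glue b (skolem-terms a b) (premise-sub a b) (hr A)) skolem-conclusion))
      (choice-allN a b (wt-StarEnding B) (Monotone-⇒wk b (hr A) mB′)
        (allNI a (monotone-ipN b (wt-StarEnding B) (hr A) (exFree-hr A) mB′ (impI premise⇒conclusion)))))
    (exNE Us (hyp (here refl)) (impI
      (exNE a (cast (exN-sub a (var ∘ inr Us) (hr A)) (iff-⇒ eqA (var ∘ inr Us) (hyp (here refl))))
        (cast (sym (subF-fuse (λ _ → refl) B))
          (from-hr eqB (var ∘ inr a ∘ inr Us) (skolem-terms a b)
            (impE (weaken (allNE-vars a (hyp (there (here refl))))) (hyp (here refl))))))))
    where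
    a = wt A
    b = wt B
    Us = map (arrows a) b
    B′ : Fm (b ++ a ++ Γ)
    B′ = subF (liftN b (var ∘ inr a)) (hr B)
    mB′ : Monotone b B′
    mB′ = Monotone-liftN b (var ∘ inr a) (hr-monotone B)
    premise⇒conclusion : (hr A ∷ map (wkN a) (Imp A B ∷ [])) ⊢ exN b B′
    premise⇒conclusion = cast (exN-sub b (var ∘ inr a) (hr B))
      (iff-⇒ eqB (var ∘ inr a) (impE (hyp (there (here refl)))
        (from-hr eqA (var ∘ inr a) (var ∘ inl a) (cast (sym (subF-≗id (glue-vars a) (hr A))) (hyp (here refl))))))
    skolem-conclusion : subF (skolem-sub a b) B′ ≡ subF (conclusion-sub a b) (hr B)
    skolem-conclusion = subF-fuse (λ v →
      trans (glue-⊙-liftN b (skolem-terms a b) (premise-sub a b) (var ∘ inr a) v)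
            (glue-cong b {f = skolem-terms a b} {g′ = var ∘ inr a ∘ inr Us}
                       (λ _ → refl) (liftN-inr a (var ∘ inr Us)) v)) (hr B)

  HR-All : ∀ {Γ σ} {A : Fm (σ ∷ Γ)} → [] ⊢ Iff A (HR A) → [] ⊢ Iff (All σ A) (HR (All σ A))
  HR-All {σ = σ} {A} eqA = iff-intro
    (monotone-choiceN (wt A) (wt-StarEnding A) (hr-monotone A) (allI (to-HR eqA (allE-fresh (hyp (here refl))))))
    (exNE Xs (hyp (here refl))
      (allI (from-hr eqA (lift (var ∘ inr Xs)) (apply-at-vars σ (wt A)) (allE-fresh (hyp (here refl))))))
    where Xs = map (σ ⇒_) (wt A)

  HR-Ex : ∀ {Γ σ} {A : Fm (σ ∷ Γ)} → [] ⊢ Iff A (HR A) → [] ⊢ Iff (Ex σ A) (HR (Ex σ A))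
  HR-Ex {Γ} {σ} {A} eqA = iff-intro
    (exE (hyp (here refl)) (exNE a (to-HR eqA (hyp (here refl)))
      (cast (sym (subF-fuse (λ _ → refl) (HR (Ex σ A))))
        (exNI-sub ((σ *) ∷ a) witnesses (var ∘ inr a ∘ vs)
          (bexI z (Mem-sng z)
            (cast (sym (trans (cong _[ z ] (subF-fuse (lift-glue-⊙-witness σ a witnesses (var ∘ inr a ∘ vs)) (hr A)))
                              (subF-fuse-id (reinstate a) (hr A))))
              (hyp (here refl))))))))
    (exNE ((σ *) ∷ a) (hyp (here refl)) (bexE (hyp (here refl))
      (exI (var vz) (cast (sym (trans (subF-comp _ _ _) (subF-fuse (λ { vz → refl ; (vs u) → refl }) A)))
        (from-hr eqA (var vz ▸ (var ∘ vs ∘ vs ∘ inr a)) (var ∘ vs ∘ vs ∘ inl a) (hyp (here refl)))))))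
    where
    a = wt A
    z : Tm (a ++ σ ∷ Γ) σ
    z = var (inr a vz)
    witnesses : Sub ((σ *) ∷ a) (a ++ σ ∷ Γ)
    witnesses vz     = app sng z
    witnesses (vs w) = var (inl a w)

  HR-BAll : ∀ {Γ σ} {t : Tm Γ (σ *)} {A : Fm (σ ∷ Γ)} →
            [] ⊢ Iff A (HR A) → [] ⊢ Iff (BAll t A) (HR (BAll t A))
  HR-BAll {Γ} {σ} {t} {A} eqA = iff-intro
    (exNE Xs collected (exNI-sub a sups (var ∘ inr Xs)
      (cast (cong₂ BAll (sym (wkNT-glue a sups (var ∘ inr Xs) t))
                        (sym (subF-fuse (lift-glue-⊙-bound a sups (var ∘ inr Xs)) (hr A))))
        (ballI (hr-monotone A (apply-at-vars σ a) (wkT ∘ sups) (apply-at-rest σ a) below-sups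
          (impE (allE-vz (hyp (there (here refl)))) (cast (sym member) (hyp (here refl)))))))))
    (exNE a (hyp (here refl))
      (ballI (from-hr eqA (lift (var ∘ inr a)) (var ∘ vs ∘ inl a) (ballE-fresh {S = wkNT a t} (hyp (here refl))))))
    where
    a = wt A
    Xs = map (σ ⇒_) a
    z∈t : Fm (σ ∷ Γ)
    z∈t = Mem (var vz) (wkT t)
    collected : (BAll t A ∷ []) ⊢ exN Xs (All σ (subF (apply-at σ a) (Imp (wkN a z∈t) (hr A))))
    collected = monotone-choiceN a (wt-StarEnding A) (Monotone-⇒wk a z∈t (hr-monotone A))
      (allI (monotone-ipN a (wt-StarEnding A) z∈t tt (hr-monotone A)
        (impI (to-HR eqA (ballE-fresh {S = t} (hyp (here refl)))))))
    -- X̲ z works for each z ∈ t separately; sup {X_i z | z ∈ t} works for all of them by monotonicity.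
    X : ∀ {τ} → Var a τ → Tm (Xs ++ Γ) (σ ⇒ τ)
    X i = var (inl Xs (mapVar (σ ⇒_) i))
    sups : Sub a (Xs ++ Γ)
    sups i = supT (lookupVar (wt-StarEnding A) i) (image (wkNT Xs t) (X i))
    member : subF (apply-at σ a) (wkN a z∈t) ≡ Mem (var vz) (wkT (wkNT Xs t))
    member = trans (wkN-glue a (apply-at-vars σ a) (apply-at-rest σ a) z∈t)
                   (cong (Mem (var vz)) (trans (subT-fuse (λ _ → refl) t) (sym (subT-comp _ _ t))))
    below-sups : ∀ {Θ} → (Mem (var vz) (wkT (wkNT Xs t)) ∷ Θ) ⊢ apply-at-vars σ a ≤ₛ wkT ∘ sups
    below-sups {τ = τ} i =
      cast (cong (Le τ _) (sym (supT-wk (lookupVar (wt-StarEnding A) i) (image (wkNT Xs t) (X i)))))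
        (Le-sup (lookupVar (wt-StarEnding A) i) (Mem-image (wkT (X i)) (hyp (here refl))))

  HR-BEx : ∀ {Γ σ} {t : Tm Γ (σ *)} {A : Fm (σ ∷ Γ)} →
           [] ⊢ Iff A (HR A) → [] ⊢ Iff (BEx t A) (HR (BEx t A))
  HR-BEx {Γ} {σ} {t} {A} eqA = iff-intro
    (bexE (hyp (here refl)) (exNE a (to-HR eqA (hyp (here refl)))
      (cast (sym (subF-fuse (λ _ → refl) (HR (BEx t A))))
        (exNI-sub a (var ∘ inl a) (var ∘ inr a ∘ vs)
          (cast (cong₂ BEx (sym (wkNT-glue a (var ∘ inl a) (var ∘ inr a ∘ vs) t))
                           (sym (subF-fuse (lift-glue-⊙-bound a (var ∘ inl a) (var ∘ inr a ∘ vs)) (hr A))))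
            (bexI (var (inr a vz)) (cast (cong (Mem _) (subT-fuse (λ _ → refl) t)) (hyp (there (there (here refl)))))
              (cast (sym (subF-fuse-id (reinstate a) (hr A))) (hyp (here refl)))))))))
    (exNE a (hyp (here refl)) (bexE (hyp (here refl))
      (bexI (var vz) (hyp (there (here refl)))
        (cast (sym (inst-vz-lift-wk _)) (from-hr eqA (lift (var ∘ inr a)) (var ∘ vs ∘ inl a) (hyp (here refl)))))))
    where a = wt A

  HR-equivalent : ∀ {Γ} (A : Fm Γ) → [] ⊢ Iff A (HR A)
  HR-equivalent Bot        = iff-refl Bot
  HR-equivalent (Eq t q)   = iff-refl (Eq t q)
  HR-equivalent (Mem t q)  = iff-refl (Mem t q)
  HR-equivalent (R r ts)   = iff-refl (R r ts)
  HR-equivalent (Or A B)   = HR-Or (HR-equivalent A) (HR-equivalent B)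
  HR-equivalent (And A B)  = HR-And (HR-equivalent A) (HR-equivalent B)
  HR-equivalent (Imp A B)  = HR-Imp (HR-equivalent A) (HR-equivalent B)
  HR-equivalent (All σ A)  = HR-All (HR-equivalent A)
  HR-equivalent (Ex σ A)   = HR-Ex (HR-equivalent A)
  HR-equivalent (BAll t A) = HR-BAll (HR-equivalent A)
  HR-equivalent (BEx t A)  = HR-BEx (HR-equivalent A)


theorem7 : (L : Language) → let open Logic L in
           (Γ : Ctx) (A : Fm Γ) → [] ⊢ Iff A (HR A)
theorem7 L Γ A = HR-equivalent L A
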